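{- For all $n\ge j\ge 0$ and $k\ge 3$, $$N(n,j,k)=a^{(k-1)}_{n,231,n-j}=\sum_{n-j\ge i_{k-2}\ge\cdots\ge i_1\ge 0}\ \prod_{m=0}^{k-2}\binom{i_{m+2}+i_m}{2i_{m+1}},$$ where $i_0:=0$, $i_{k-1}:=n-j$, $i_k:=n$, and the sum is over integers $i_1,\dots,i_{k-2}$.
   Context: An ordered tree is a rooted tree whose vertices' children are linearly ordered; its height is the maximum distance from a vertex to the root, and a leaf is a vertex with no children. $N(n,j,k)$ is the number of ordered trees with $n$ edges, $j$ leaves and height at most $k$, with the convention $N(0,0,k)=1$. For $n\ge 1$ and $j,k\ge 0$, $a^{(k)}_{n,231,j}$ denotes the number of permutations $\sigma=\sigma_1\cdots\sigma_n$ of $[n]$ that avoid $231$ (no indices $a<b<c$ with $\sigma_c<\sigma_a<\sigma_b$), have exactly $j$ descents (indices $i\in[n-1]$ with $\sigma_i>\sigma_{i+1}$), and satisfy $\max\{i-\sigma_i: i\in[n]\}\le k$; for $n=0$, $a^{(k)}_{0,231,0}=1$ and $a^{(k)}_{0,231,j}=0$ for $j>0$. -}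

module Defs where

open import Data.Nat using (ℕ; zero; suc; _+_; _*_; _∸_; _≤_; _<_; _⊔_; _≤?_)
open import Data.Nat.Combinatorics using (_C_)
open import Data.Fin as Fin using (Fin; toℕ)
open import Data.Vec using (Vec; lookup; toList)
open import Data.List using (List; []; _∷_; _++_; [_]; map; concatMap; upTo; length)
open import Data.List.Relation.Unary.Unique.Propositional using (Unique)
open import Data.List.Membership.Propositional using (_∈_)
open import Data.Product using (Σ; ∃; ∃-syntax; _×_; _,_)
open import Data.Bool using (if_then_else_)
open import Relation.Nullary using (¬_; does)
open import Relation.Binary.PropositionalEquality using (_≡_)
open import Function.Bundles using (_⇔_)

HasCard : (A : Set) → (A → Set) → ℕ → Set
HasCard A P m = Σ (List A) λ xs → Unique xs × length xs ≡ m × (∀ x → (x ∈ xs) ⇔ P x)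

-- Ordered (plane) trees: a vertex with a linearly ordered list of children.

data Tree : Set where
  node : List Tree → Tree

mutual
  edges : Tree → ℕ
  edges (node ts) = edgesL ts

  edgesL : List Tree → ℕ
  edgesL []       = 0
  edgesL (t ∷ ts) = suc (edges t) + edgesL ts

mutual
  leaves : Tree → ℕ
  leaves (node [])       = 1
  leaves (node (t ∷ ts)) = leavesL (t ∷ ts)

  leavesL : List Tree → ℕ
  leavesL []       = 0
  leavesL (t ∷ ts) = leaves t + leavesL ts

mutual
  height : Tree → ℕ
  height (node ts) = heightL ts

  heightL : List Tree → ℕ
  heightL []       = 0
  heightL (t ∷ ts) = suc (height t) ⊔ heightL ts

-- The trees counted by N(n,j,k).  For n = 0 the paper's convention
-- N(0,0,k) = 1 is built in: we count the one-vertex tree iff j = 0.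
TreeP : ℕ → ℕ → ℕ → Tree → Set
TreeP zero    j k t = edges t ≡ 0 × j ≡ 0
TreeP (suc n) j k t = edges t ≡ suc n × leaves t ≡ j × height t ≤ k

-- Permutations of [n], written in one-line notation σ = σ₁⋯σₙ as a
-- vector of length n (positions and values 0-indexed).

IsPerm : {n : ℕ} → Vec (Fin n) n → Set
IsPerm {n} σ = (∀ i j → lookup σ i ≡ lookup σ j → i ≡ j)
             × (∀ y → ∃[ i ] lookup σ i ≡ y)

Avoids231 : {n : ℕ} → Vec (Fin n) n → Set
Avoids231 {n} σ = ¬ (Σ (Fin n) λ a → Σ (Fin n) λ b → Σ (Fin n) λ c →
   a Fin.< b × b Fin.< c × lookup σ c Fin.< lookup σ a × lookup σ a Fin.< lookup σ b)

desL : List ℕ → ℕ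
desL []           = 0
desL (x ∷ [])     = 0
desL (x ∷ y ∷ ws) = (if does (suc y ≤? x) then 1 else 0) + desL (y ∷ ws)

des : {n : ℕ} → Vec (Fin n) n → ℕ
des σ = desL (map toℕ (toList σ))

-- max { i - σ_i } ≤ k   (equivalently i ≤ σ_i + k for all i)
MaxDropLe : {n : ℕ} → Vec (Fin n) n → ℕ → Set
MaxDropLe {n} σ k = ∀ (i : Fin n) → toℕ i ≤ toℕ (lookup σ i) + k

PermP : (n j k : ℕ) → Vec (Fin n) n → Set
PermP n j k σ = IsPerm σ × Avoids231 σ × des σ ≡ j × MaxDropLe σ k

range : ℕ → ℕ → List ℕ
range lo B = map (lo +_) (upTo (suc B ∸ lo))

incSeqs : ℕ → ℕ → ℕ → List (List ℕ)
incSeqs zero    lo B = [ [] ]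
incSeqs (suc L) lo B = concatMap (λ x → map (x ∷_) (incSeqs L x B)) (range lo B)

prodTerm : List ℕ → ℕ
prodTerm (a ∷ b ∷ c ∷ r) = ((c + a) C (2 * b)) * prodTerm (b ∷ c ∷ r)
prodTerm _               = 1

sumL : List ℕ → ℕ
sumL []       = 0
sumL (x ∷ xs) = x + sumL xs

binomSum : ℕ → ℕ → ℕ → ℕ
binomSum n j k = sumL (map (λ is → prodTerm (0 ∷ is ++ (n ∸ j) ∷ n ∷ []))
                           (incSeqs (k ∸ 2) 0 (n ∸ j)))

-- Both families are put in bijection with forests (lists of ordered trees).  A
-- tree is a root over a forest F, its edges are the vertices of F, and these
-- split into leaves and inner vertices.  Let ForestP h j a be the forests of
-- height ≤ h with j leaves and a inner vertices.
--
--  1. Counting forests.  Pruning all leaves of F gives a forest G of height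
--     ≤ h − 1 with a vertices; F is recovered from G by distributing its j
--     leaves over the 2a + 1 gaps of G, gaps below childless vertices of G
--     receiving at least one leaf.  If G has w inner vertices there are
--     C(j + a + w, 2a) such distributions, giving a recursion in h for the
--     number of forests, which a Fubini-type rearrangement of binomSum solves.
--  2. Forests as permutations.  The word of a forest lists the size v of the
--     first subforest, then the word of that subforest, then the word of the
--     remaining forest shifted by v + 1.  This is a bijection onto the
--     231-avoiding permutation words, carrying inner vertices to descents and
--     height ≤ h to "i < σᵢ + h for all positions i".
--  3. Permutations as words.  Vectors σ : Vec (Fin n) n correspond to their
--     words of values, translating PermP into the list-level predicates.
--
-- The theorem follows by transporting the count of forests along the two
-- bijections.
module Submission where

open import Defs
open import Data.Nat using (ℕ; zero; suc; _+_; _*_; _∸_; _≤_; _<_; _⊔_; z≤n; s≤s; _≤?_; _<?_)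
open import Data.Nat.Properties
open import Data.Nat.Combinatorics using (_C_; nCk+nC[k+1]≡[n+1]C[k+1]; nCk≡nC[n∸k]; nCn≡1)
open import Data.Nat.Solver using (module +-*-Solver)
open import Data.Bool using (Bool; true; false; if_then_else_)
open import Data.Unit using (⊤; tt)
open import Data.Empty using (⊥; ⊥-elim)
open import Data.Product using (Σ; ∃-syntax; _×_; _,_; proj₁; proj₂)
open import Data.Sum using (inj₁; inj₂)
open import Data.List using (List; []; _∷_; _++_; [_]; map; concatMap; length; replicate; take; drop; applyUpTo; upTo)
open import Data.List.Properties using (length-++; length-map; map-++; map-cong; map-∘; map-upTo; length-upTo; ++-assoc; ++-identityʳ; take++drop≡id; ∷-injective; ∷-injectiveʳ)
open import Data.List.Relation.Unary.All as All using (All; []; _∷_)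
import Data.List.Relation.Unary.All.Properties as All
open import Data.List.Relation.Unary.Any using (here; there)
open import Data.List.Relation.Unary.AllPairs using ([]; _∷_)
open import Data.List.Relation.Unary.Unique.Propositional using (Unique)
import Data.List.Relation.Unary.Unique.Propositional.Properties as Unique
open import Data.List.Membership.Propositional using (_∈_)
open import Data.List.Membership.Propositional.Properties using (∈-map⁺; ∈-map⁻; ∈-++⁺ˡ; ∈-++⁺ʳ; ∈-++⁻; ∈-∃++; ∈-upTo⁺; ∈-upTo⁻)
open import Data.Fin as Fin using (Fin; toℕ; fromℕ<)
open import Data.Fin.Properties using (toℕ-injective; toℕ<n; toℕ-fromℕ<)
open import Data.Vec using (Vec; []; _∷_; lookup; toList)
open import Relation.Nullary using (¬_; yes; no; does)
open import Relation.Nullary.Decidable using (dec-true; dec-false)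
open import Relation.Binary.Definitions using (tri<; tri≈; tri>)
open import Relation.Binary.PropositionalEquality using (_≡_; _≢_; refl; sym; trans; cong; cong₂; subst; module ≡-Reasoning)
open import Function.Bundles using (_⇔_; mk⇔; Equivalence)

private variable
  A B : Set

∈-concatMap⁺ : {f : A → List B} {xs : List A} {x : A} {y : B} → x ∈ xs → y ∈ f x → y ∈ concatMap f xs
∈-concatMap⁺ {xs = x ∷ xs} (here refl) y∈ = ∈-++⁺ˡ y∈
∈-concatMap⁺ {f = f} {xs = x ∷ xs} (there x∈) y∈ = ∈-++⁺ʳ (f x) (∈-concatMap⁺ {f = f} x∈ y∈)

∈-concatMap⁻ : (f : A → List B) (xs : List A) {y : B} → y ∈ concatMap f xs → ∃[ x ] (x ∈ xs × y ∈ f x)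
∈-concatMap⁻ f (x ∷ xs) y∈ with ∈-++⁻ (f x) y∈
... | inj₁ p = x , here refl , p
... | inj₂ p with ∈-concatMap⁻ f xs p
...   | z , z∈ , q = z , there z∈ , q

sumL-++ : (xs ys : List ℕ) → sumL (xs ++ ys) ≡ sumL xs + sumL ys
sumL-++ [] ys = refl
sumL-++ (x ∷ xs) ys = trans (cong (x +_) (sumL-++ xs ys)) (sym (+-assoc x _ _))

sumL-cong : (f g : A → ℕ) (xs : List A) → (∀ x → x ∈ xs → f x ≡ g x) → sumL (map f xs) ≡ sumL (map g xs)
sumL-cong f g [] eq = refl
sumL-cong f g (x ∷ xs) eq = cong₂ _+_ (eq x (here refl)) (sumL-cong f g xs (λ y y∈ → eq y (there y∈)))

sumL-map-map : (g : B → ℕ) (f : A → B) (xs : List A) → sumL (map g (map f xs)) ≡ sumL (map (λ x → g (f x)) xs)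
sumL-map-map g f [] = refl
sumL-map-map g f (x ∷ xs) = cong (g (f x) +_) (sumL-map-map g f xs)

sumL-concatMap : (g : B → ℕ) (f : A → List B) (xs : List A) →
  sumL (map g (concatMap f xs)) ≡ sumL (map (λ x → sumL (map g (f x))) xs)
sumL-concatMap g f [] = refl
sumL-concatMap g f (x ∷ xs) = begin
  sumL (map g (f x ++ concatMap f xs))              ≡⟨ cong sumL (map-++ g (f x) (concatMap f xs)) ⟩
  sumL (map g (f x) ++ map g (concatMap f xs))      ≡⟨ sumL-++ (map g (f x)) _ ⟩
  sumL (map g (f x)) + sumL (map g (concatMap f xs)) ≡⟨ cong (sumL (map g (f x)) +_) (sumL-concatMap g f xs) ⟩
  sumL (map g (f x)) + sumL (map (λ x → sumL (map g (f x))) xs) ∎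
  where open ≡-Reasoning

length-concatMap : (f : A → List B) (xs : List A) → length (concatMap f xs) ≡ sumL (map (λ x → length (f x)) xs)
length-concatMap f [] = refl
length-concatMap f (x ∷ xs) = trans (length-++ (f x)) (cong (length (f x) +_) (length-concatMap f xs))

sumL-const : (c : ℕ) (xs : List A) → sumL (map (λ _ → c) xs) ≡ length xs * c
sumL-const c [] = refl
sumL-const c (x ∷ xs) = cong (c +_) (sumL-const c xs)

sumL-+ : (f g : A → ℕ) (xs : List A) → sumL (map (λ x → f x + g x) xs) ≡ sumL (map f xs) + sumL (map g xs)
sumL-+ f g [] = refl
sumL-+ f g (x ∷ xs) = trans (cong (f x + g x +_) (sumL-+ f g xs)) (interchange (f x) (g x) _ _)
  where
  open +-*-Solver
  interchange : ∀ a b c d → (a + b) + (c + d) ≡ (a + c) + (b + d)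
  interchange = solve 4 (λ a b c d → (a :+ b) :+ (c :+ d) := (a :+ c) :+ (b :+ d)) refl

sumL-*ʳ : (f : A → ℕ) (c : ℕ) (xs : List A) → sumL (map (λ x → f x * c) xs) ≡ sumL (map f xs) * c
sumL-*ʳ f c [] = refl
sumL-*ʳ f c (x ∷ xs) = trans (cong (f x * c +_) (sumL-*ʳ f c xs)) (sym (*-distribʳ-+ c (f x) _))

sumL-zero : (f : A → ℕ) (xs : List A) → (∀ x → x ∈ xs → f x ≡ 0) → sumL (map f xs) ≡ 0
sumL-zero f [] vanish = refl
sumL-zero f (x ∷ xs) vanish = cong₂ _+_ (vanish x (here refl)) (sumL-zero f xs (λ y y∈ → vanish y (there y∈)))

Unique-map : (f : A → B) (xs : List A) → (∀ {x y} → x ∈ xs → y ∈ xs → f x ≡ f y → x ≡ y) →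
             Unique xs → Unique (map f xs)
Unique-map f [] inj u = []
Unique-map f (x ∷ xs) inj (x∉ ∷ u) =
  All.tabulate fresh ∷ Unique-map f xs (λ p q → inj (there p) (there q)) u
  where
  fresh : ∀ {y} → y ∈ map f xs → f x ≢ y
  fresh y∈ eq with ∈-map⁻ f y∈
  ... | z , z∈ , refl = All.lookup x∉ z∈ (inj (here refl) (there z∈) eq)

Unique-concatMap : (f : A → List B) (π : B → A) (xs : List A) → Unique xs → (∀ x → x ∈ xs → Unique (f x)) →
                   (∀ x y → x ∈ xs → y ∈ f x → π y ≡ x) → Unique (concatMap f xs)
Unique-concatMap f π [] u uf label = []
Unique-concatMap f π (x ∷ xs) (x∉ ∷ u) uf label =
  Unique.++⁺ (uf x (here refl))
             (Unique-concatMap f π xs u (λ y y∈ → uf y (there y∈)) (λ a b a∈ → label a b (there a∈)))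
             disjoint
  where
  disjoint : ∀ {z} → ¬ (z ∈ f x × z ∈ concatMap f xs)
  disjoint (z∈fx , z∈rest) with ∈-concatMap⁻ f xs z∈rest
  ... | w , w∈ , z∈fw = All.lookup x∉ w∈ (trans (sym (label x _ (here refl) z∈fx)) (label w _ (there w∈) z∈fw))

HasCard-bij : {P : A → Set} {Q : B → Set} {m : ℕ} (f : A → B) →
              (∀ {x y} → P x → P y → f x ≡ f y → x ≡ y) →
              (∀ x → P x → Q (f x)) → (∀ y → Q y → ∃[ x ] (P x × f x ≡ y)) →
              HasCard A P m → HasCard B Q m
HasCard-bij {P = P} {Q} f inj into onto (xs , u , len , mem) =
  map f xs , Unique-map f xs (λ a b → inj (to a) (to b)) u , trans (length-map f xs) len ,
  λ y → mk⇔ (image y) (preimage y)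
  where
  to : ∀ {x} → x ∈ xs → P x
  to = Equivalence.to (mem _)
  image : ∀ y → y ∈ map f xs → Q y
  image y y∈ with ∈-map⁻ f y∈
  ... | x , x∈ , refl = into x (to x∈)
  preimage : ∀ y → Q y → y ∈ map f xs
  preimage y q with onto y q
  ... | x , px , refl = ∈-map⁺ f (Equivalence.from (mem x) px)

-- number of compositions of n into k positive parts
posComps : ℕ → ℕ → ℕ
posComps zero    zero    = 1
posComps zero    (suc k) = 0
posComps (suc n) zero    = 0
posComps (suc n) (suc k) = posComps n k + posComps n (suc k)

posComps-< : ∀ n k → n < k → posComps n k ≡ 0
posComps-< zero    (suc k) _         = refl
posComps-< (suc n) (suc k) (s≤s n<k) =
  cong₂ _+_ (posComps-< n k n<k) (posComps-< n (suc k) (m<n⇒m<1+n n<k))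

nC0≡1 : ∀ n → n C 0 ≡ 1
nC0≡1 n = trans (nCk≡nC[n∸k] {0} {n} z≤n) (nCn≡1 n)

-- stars and bars: Pascal's rule is the defining recursion of posComps
posComps≡C : ∀ n k → posComps (suc n) (suc k) ≡ n C k
posComps≡C zero    zero    = refl
posComps≡C zero    (suc k) = refl
posComps≡C (suc n) zero    = trans (posComps≡C n 0) (trans (nC0≡1 n) (sym (nC0≡1 (suc n))))
posComps≡C (suc n) (suc k) =
  trans (cong₂ _+_ (posComps≡C n k) (posComps≡C n (suc k))) (nCk+nC[k+1]≡[n+1]C[k+1] n k)

Fits : List Bool → List ℕ → Set
Fits []           []      = ⊤
Fits []           (_ ∷ _) = ⊥
Fits (_ ∷ _)      []      = ⊥
Fits (false ∷ bs) (x ∷ c) = Fits bs c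
Fits (true ∷ bs)  (x ∷ c) = 1 ≤ x × Fits bs c

bumpHead : List ℕ → List ℕ
bumpHead []      = []
bumpHead (x ∷ c) = suc x ∷ c

bumpHead-injective : ∀ {c d} → bumpHead c ≡ bumpHead d → c ≡ d
bumpHead-injective {[]}    {[]}    eq   = refl
bumpHead-injective {x ∷ c} {y ∷ d} refl = refl

-- the first entry is either 0 (recurse on the rest) or positive (take one
-- unit off it; the first cell then becomes a cell allowing 0)
compositions : List Bool → ℕ → List (List ℕ)
compositions []           zero    = [ [] ]
compositions []           (suc j) = []
compositions (false ∷ bs) zero    = map (0 ∷_) (compositions bs zero)
compositions (false ∷ bs) (suc j) =
  map (0 ∷_) (compositions bs (suc j)) ++ map bumpHead (compositions (false ∷ bs) j)
compositions (true ∷ bs)  zero    = []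
compositions (true ∷ bs)  (suc j) = map bumpHead (compositions (false ∷ bs) j)

zeroable : List Bool → ℕ
zeroable []           = 0
zeroable (false ∷ bs) = suc (zeroable bs)
zeroable (true ∷ bs)  = zeroable bs

zeroable≤length : ∀ bs → zeroable bs ≤ length bs
zeroable≤length []           = z≤n
zeroable≤length (false ∷ bs) = s≤s (zeroable≤length bs)
zeroable≤length (true ∷ bs)  = m≤n⇒m≤1+n (zeroable≤length bs)

-- adding one to each zeroable cell, compositions of j fitting bs become
-- positive compositions of j + zeroable bs into length bs parts
length-compositions : ∀ bs j → length (compositions bs j) ≡ posComps (j + zeroable bs) (length bs)
length-compositions []           zero    = refl
length-compositions []           (suc j) = refl
length-compositions (false ∷ bs) zero    =
  trans (length-map (0 ∷_) (compositions bs zero))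
    (trans (length-compositions bs zero)
      (sym (trans (cong (posComps (zeroable bs) (length bs) +_)
                        (posComps-< (zeroable bs) (suc (length bs)) (s≤s (zeroable≤length bs))))
                  (+-identityʳ _))))
length-compositions (false ∷ bs) (suc j) = begin
  length (map (0 ∷_) (compositions bs (suc j)) ++ map bumpHead (compositions (false ∷ bs) j))
    ≡⟨ length-++ (map (0 ∷_) (compositions bs (suc j))) ⟩
  length (map (0 ∷_) (compositions bs (suc j))) + length (map bumpHead (compositions (false ∷ bs) j))
    ≡⟨ cong₂ _+_ (length-map (0 ∷_) (compositions bs (suc j))) (length-map bumpHead (compositions (false ∷ bs) j)) ⟩
  length (compositions bs (suc j)) + length (compositions (false ∷ bs) j)
    ≡⟨ cong₂ _+_ (length-compositions bs (suc j)) (length-compositions (false ∷ bs) j) ⟩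
  posComps (suc j + zeroable bs) (length bs) + posComps (j + suc (zeroable bs)) (suc (length bs))
    ≡⟨ cong (λ m → posComps m (length bs) + posComps (j + suc (zeroable bs)) (suc (length bs))) (sym (+-suc j (zeroable bs))) ⟩
  posComps (suc j + suc (zeroable bs)) (suc (length bs)) ∎
  where open ≡-Reasoning
length-compositions (true ∷ bs)  zero    = sym (posComps-< (zeroable bs) (suc (length bs)) (s≤s (zeroable≤length bs)))
length-compositions (true ∷ bs)  (suc j) =
  trans (length-map bumpHead (compositions (false ∷ bs) j))
    (trans (length-compositions (false ∷ bs) j) (cong (λ m → posComps m (suc (length bs))) (+-suc j (zeroable bs))))

IsComposition : List Bool → ℕ → List ℕ → Set
IsComposition bs j c = Fits bs c × sumL c ≡ j

compositions-sound : ∀ bs j → All (IsComposition bs j) (compositions bs j)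
compositions-sound []           zero    = (tt , refl) ∷ []
compositions-sound []           (suc j) = []
compositions-sound (false ∷ bs) zero    = All.map⁺ (compositions-sound bs zero)
compositions-sound (false ∷ bs) (suc j) =
  All.++⁺ (All.map⁺ (compositions-sound bs (suc j)))
          (All.map⁺ (All.map (λ {c} → bump {c}) (compositions-sound (false ∷ bs) j)))
  where
  bump : ∀ {c} → IsComposition (false ∷ bs) j c → IsComposition (false ∷ bs) (suc j) (bumpHead c)
  bump {x ∷ c} (fits , sum) = fits , cong suc sum
compositions-sound (true ∷ bs)  zero    = []
compositions-sound (true ∷ bs)  (suc j) = All.map⁺ (All.map (λ {c} → bump {c}) (compositions-sound (false ∷ bs) j))
  where
  bump : ∀ {c} → IsComposition (false ∷ bs) j c → IsComposition (true ∷ bs) (suc j) (bumpHead c)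
  bump {x ∷ c} (fits , sum) = (s≤s z≤n , fits) , cong suc sum

compositions-complete : ∀ bs j c → IsComposition bs j c → c ∈ compositions bs j
compositions-complete []           zero    []          _             = here refl
compositions-complete (false ∷ bs) zero    (zero ∷ c)  (fits , sum)  =
  ∈-map⁺ (0 ∷_) (compositions-complete bs zero c (fits , sum))
compositions-complete (false ∷ bs) (suc j) (zero ∷ c)  (fits , sum)  =
  ∈-++⁺ˡ (∈-map⁺ (0 ∷_) (compositions-complete bs (suc j) c (fits , sum)))
compositions-complete (false ∷ bs) (suc j) (suc x ∷ c) (fits , sum)  =
  ∈-++⁺ʳ (map (0 ∷_) (compositions bs (suc j)))
         (∈-map⁺ bumpHead (compositions-complete (false ∷ bs) j (x ∷ c) (fits , suc-injective sum)))
compositions-complete (true ∷ bs)  (suc j) (suc x ∷ c) ((_ , fits) , sum) =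
  ∈-map⁺ bumpHead (compositions-complete (false ∷ bs) j (x ∷ c) (fits , suc-injective sum))
compositions-complete (true ∷ bs)  j       (zero ∷ c)  ((() , _) , _)

compositions-unique : ∀ bs j → Unique (compositions bs j)
compositions-unique []           zero    = [] ∷ []
compositions-unique []           (suc j) = []
compositions-unique (false ∷ bs) zero    = Unique.map⁺ ∷-injectiveʳ (compositions-unique bs zero)
compositions-unique (false ∷ bs) (suc j) =
  Unique.++⁺ (Unique.map⁺ ∷-injectiveʳ (compositions-unique bs (suc j)))
             (Unique.map⁺ bumpHead-injective (compositions-unique (false ∷ bs) j))
             zeroHead≢bumped
  where
  zeroHead≢bumped : ∀ {z} → ¬ (z ∈ map (0 ∷_) (compositions bs (suc j)) × z ∈ map bumpHead (compositions (false ∷ bs) j))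
  zeroHead≢bumped (z∈₁ , z∈₂) with ∈-map⁻ (0 ∷_) z∈₁ | ∈-map⁻ bumpHead z∈₂
  ... | _ , _ , refl | []    , _ , ()
  ... | _ , _ , refl | _ ∷ _ , _ , ()
compositions-unique (true ∷ bs)  zero    = []
compositions-unique (true ∷ bs)  (suc j) = Unique.map⁺ bumpHead-injective (compositions-unique (false ∷ bs) j)

∈-range⁻ : ∀ {lo B z} → z ∈ range lo B → lo ≤ z × z ≤ B
∈-range⁻ {lo} {B} z∈ with ∈-map⁻ (lo +_) z∈
... | i , i∈ , refl = m≤m+n lo i , subst (_≤ B) (+-comm i lo) (≤-pred (m≤o∸n⇒m+n≤o (suc i) lo≤1+B (∈-upTo⁻ i∈)))
  where
  lo≤1+B : lo ≤ suc B
  lo≤1+B = <⇒≤ (m∸n≢0⇒n<m (λ empty → n≮0 (subst (i <_) empty (∈-upTo⁻ i∈))))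

∈-range⁺ : ∀ {lo B z} → lo ≤ z → z ≤ B → z ∈ range lo B
∈-range⁺ {lo} lo≤z z≤B = subst (_∈ range lo _) (m+[n∸m]≡n lo≤z) (∈-map⁺ (lo +_) (∈-upTo⁺ (∸-monoˡ-< (s≤s z≤B) lo≤z)))

range-unique : ∀ lo B → Unique (range lo B)
range-unique lo B = Unique.map⁺ (+-cancelˡ-≡ lo _ _) (Unique.upTo⁺ (suc B ∸ lo))

range-cons : ∀ lo B → lo ≤ B → range lo B ≡ lo ∷ range (suc lo) B
range-cons lo B lo≤B = begin
  map (lo +_) (upTo (suc B ∸ lo))          ≡⟨ cong (λ m → map (lo +_) (upTo m)) (+-∸-assoc 1 lo≤B) ⟩
  lo + 0 ∷ map (lo +_) (applyUpTo suc m)   ≡⟨ cong₂ _∷_ (+-identityʳ lo) (cong (map (lo +_)) (sym (map-upTo suc m))) ⟩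
  lo ∷ map (lo +_) (map suc (upTo m))      ≡⟨ cong (lo ∷_) (sym (map-∘ (upTo m))) ⟩
  lo ∷ map (λ i → lo + suc i) (upTo m)     ≡⟨ cong (lo ∷_) (map-cong (+-suc lo) (upTo m)) ⟩
  lo ∷ map (suc lo +_) (upTo m)            ∎
  where
  open ≡-Reasoning
  m = B ∸ lo

range-empty : ∀ lo B → B < lo → range lo B ≡ []
range-empty lo B B<lo = cong (λ m → map (lo +_) (upTo m)) (m≤n⇒m∸n≡0 B<lo)

triangle-swap-size : ∀ B (g : ℕ → ℕ → ℕ) c lo → c + lo ≡ suc B →
  sumL (map (λ x → sumL (map (g x) (range x B))) (range lo B)) ≡
  sumL (map (λ z → sumL (map (λ x → g x z) (range lo z))) (range lo B))
triangle-swap-size B g zero    lo size rewrite range-empty lo B (≤-reflexive (sym size)) = refl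
triangle-swap-size B g (suc c) lo size = begin
  sumL (map (λ x → sumL (map (g x) (range x B))) (range lo B))
    ≡⟨ cong (λ r → sumL (map (λ x → sumL (map (g x) (range x B))) r)) (range-cons lo B lo≤B) ⟩
  first + sumL (map (λ x → sumL (map (g x) (range x B))) (range (suc lo) B))
    ≡⟨ cong (first +_) (triangle-swap-size B g c (suc lo) (trans (+-suc c lo) size)) ⟩
  first + sumL (map innerSum (range (suc lo) B))
    ≡⟨ cong (first +_) (sym innerSumAtLo) ⟩
  first + sumL (map innerSum (range lo B))
    ≡⟨ sym (sumL-+ (g lo) innerSum (range lo B)) ⟩
  sumL (map (λ z → g lo z + innerSum z) (range lo B))
    ≡⟨ sumL-cong _ _ (range lo B) (λ z z∈ → cong (λ r → sumL (map (λ x → g x z) r))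
                                    (sym (range-cons lo z (proj₁ (∈-range⁻ z∈))))) ⟩
  sumL (map (λ z → sumL (map (λ x → g x z) (range lo z))) (range lo B)) ∎
  where
  open ≡-Reasoning
  lo≤B : lo ≤ B
  lo≤B = ≤-pred (subst (lo <_) size (s≤s (m≤n+m lo c)))
  first : ℕ
  first = sumL (map (g lo) (range lo B))
  innerSum : ℕ → ℕ
  innerSum z = sumL (map (λ x → g x z) (range (suc lo) z))
  -- the new term z = lo of the outer sum has an empty inner sum
  innerSumAtLo : sumL (map innerSum (range lo B)) ≡ sumL (map innerSum (range (suc lo) B))
  innerSumAtLo rewrite range-cons lo B lo≤B | range-empty (suc lo) lo ≤-refl = refl

sum-triangle-swap : ∀ lo B (g : ℕ → ℕ → ℕ) →
  sumL (map (λ x → sumL (map (g x) (range x B))) (range lo B)) ≡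
  sumL (map (λ z → sumL (map (λ x → g x z) (range lo z))) (range lo B))
sum-triangle-swap lo B g with lo ≤? suc B
... | yes lo≤1+B = triangle-swap-size B g (suc B ∸ lo) lo (m∸n+n≡m lo≤1+B)
... | no  lo≰1+B rewrite range-empty lo B (≤-trans (n≤1+n (suc B)) (≰⇒> lo≰1+B)) = refl

sum-incSeqs-last : ∀ L lo B (F : List ℕ → ℕ) →
  sumL (map F (incSeqs (suc L) lo B)) ≡
  sumL (map (λ z → sumL (map (λ is → F (is ++ [ z ])) (incSeqs L lo z))) (range lo B))
sum-incSeqs-last zero    lo B F = sumL-concatMap F (λ x → map (x ∷_) [ [] ]) (range lo B)
sum-incSeqs-last (suc L) lo B F = begin
  sumL (map F (incSeqs (suc (suc L)) lo B))
    ≡⟨ sumL-concatMap F (λ x → map (x ∷_) (incSeqs (suc L) x B)) (range lo B) ⟩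
  sumL (map (λ x → sumL (map F (map (x ∷_) (incSeqs (suc L) x B)))) (range lo B))
    ≡⟨ sumL-cong _ _ (range lo B) (λ x _ → trans (sumL-map-map F (x ∷_) (incSeqs (suc L) x B))
                                                   (sum-incSeqs-last L x B (λ is → F (x ∷ is)))) ⟩
  sumL (map (λ x → sumL (map (g x) (range x B))) (range lo B))
    ≡⟨ sum-triangle-swap lo B g ⟩
  sumL (map (λ z → sumL (map (λ x → g x z) (range lo z))) (range lo B))
    ≡⟨ sumL-cong _ _ (range lo B) (λ z _ → sym (lastFixed z)) ⟩
  sumL (map (λ z → sumL (map (λ is → F (is ++ [ z ])) (incSeqs (suc L) lo z))) (range lo B)) ∎
  where
  open ≡-Reasoning
  g : ℕ → ℕ → ℕ
  g x z = sumL (map (λ is → F (x ∷ is ++ [ z ])) (incSeqs L x z))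
  lastFixed : ∀ z → sumL (map (λ is → F (is ++ [ z ])) (incSeqs (suc L) lo z)) ≡
                    sumL (map (λ x → g x z) (range lo z))
  lastFixed z = trans (sumL-concatMap (λ is → F (is ++ [ z ])) (λ x → map (x ∷_) (incSeqs L x z)) (range lo z))
                      (sumL-cong _ _ (range lo z) (λ x _ → sumL-map-map (λ is → F (is ++ [ z ])) (x ∷_) (incSeqs L x z)))

prodTerm-snoc : ∀ l a b c → prodTerm (l ++ a ∷ b ∷ c ∷ []) ≡ prodTerm (l ++ a ∷ b ∷ []) * ((c + a) C (2 * b))
prodTerm-snoc []               a b c = trans (*-identityʳ _) (sym (*-identityˡ _))
prodTerm-snoc (p ∷ [])         a b c =
  trans (cong (((b + p) C (2 * a)) *_) (*-identityʳ ((c + a) C (2 * b))))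
        (cong (_* ((c + a) C (2 * b))) (sym (*-identityʳ ((b + p) C (2 * a)))))
prodTerm-snoc (p ∷ q ∷ [])     a b c =
  trans (cong (((a + p) C (2 * q)) *_) (prodTerm-snoc (q ∷ []) a b c)) (sym (*-assoc ((a + p) C (2 * q)) _ _))
prodTerm-snoc (p ∷ q ∷ r ∷ l) a b c =
  trans (cong (((r + p) C (2 * q)) *_) (prodTerm-snoc (q ∷ r ∷ l) a b c)) (sym (*-assoc ((r + p) C (2 * q)) _ _))

-- chainSum L x y = Σ_{x ≥ i_L ≥ ⋯ ≥ i_1 ≥ 0} ∏ C(i_{m+2} + i_m, 2 i_{m+1}) with
-- i₀ = 0, i_{L+1} = x, i_{L+2} = y; thus binomSum n j k = chainSum (k ∸ 2) (n ∸ j) n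
chainSum : ℕ → ℕ → ℕ → ℕ
chainSum L x y = sumL (map (λ is → prodTerm (0 ∷ is ++ x ∷ y ∷ [])) (incSeqs L 0 x))

-- the same quantity as a recursion in the length, summing out the last free index
chainRec : ℕ → ℕ → ℕ → ℕ
chainRec zero    zero    y = 1
chainRec zero    (suc x) y = 0
chainRec (suc L) x       y = sumL (map (λ z → chainRec L z x * ((y + z) C (2 * x))) (range 0 x))

-- with no free index the sum has the single term C(y, 2x), and only the
-- summand z = 0 of the recursion survives
chainSum≡chainRec-zero : ∀ x y → chainSum 0 x y ≡ chainRec 1 x y
chainSum≡chainRec-zero x y = begin
  ((y + 0) C (2 * x)) * 1 + 0
    ≡⟨ cong (_+ 0) (trans (*-identityʳ _) (sym (*-identityˡ _))) ⟩
  term 0 + 0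
    ≡⟨ cong (term 0 +_) (sym (sumL-zero term (range 1 x) (λ z z∈ → positiveStart z (proj₁ (∈-range⁻ z∈))))) ⟩
  term 0 + sumL (map term (range 1 x))
    ≡⟨ cong (λ r → sumL (map term r)) (sym (range-cons 0 x z≤n)) ⟩
  sumL (map term (range 0 x)) ∎
  where
  open ≡-Reasoning
  term : ℕ → ℕ
  term z = chainRec zero z x * ((y + z) C (2 * x))
  positiveStart : ∀ z → 1 ≤ z → term z ≡ 0
  positiveStart (suc z) _ = refl

chainSum≡chainRec : ∀ L x y → chainSum L x y ≡ chainRec (suc L) x y
chainSum≡chainRec zero    x y = chainSum≡chainRec-zero x y
chainSum≡chainRec (suc L) x y = begin
  chainSum (suc L) x y
    ≡⟨ sum-incSeqs-last L 0 x (λ is → prodTerm (0 ∷ is ++ x ∷ y ∷ [])) ⟩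
  sumL (map (λ z → sumL (map (λ is → prodTerm (0 ∷ (is ++ [ z ]) ++ x ∷ y ∷ [])) (incSeqs L 0 z))) (range 0 x))
    ≡⟨ sumL-cong _ _ (range 0 x) (λ z _ → lastFactor z) ⟩
  chainRec (suc (suc L)) x y ∎
  where
  open ≡-Reasoning
  splitLast : ∀ z is → prodTerm (0 ∷ (is ++ [ z ]) ++ x ∷ y ∷ []) ≡ prodTerm (0 ∷ is ++ z ∷ x ∷ []) * ((y + z) C (2 * x))
  splitLast z is rewrite ++-assoc is [ z ] (x ∷ y ∷ []) = prodTerm-snoc (0 ∷ is) z x y
  lastFactor : ∀ z → sumL (map (λ is → prodTerm (0 ∷ (is ++ [ z ]) ++ x ∷ y ∷ [])) (incSeqs L 0 z)) ≡
                     chainRec (suc L) z x * ((y + z) C (2 * x))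
  lastFactor z = begin
    sumL (map (λ is → prodTerm (0 ∷ (is ++ [ z ]) ++ x ∷ y ∷ [])) (incSeqs L 0 z))
      ≡⟨ sumL-cong _ _ (incSeqs L 0 z) (λ is _ → splitLast z is) ⟩
    sumL (map (λ is → prodTerm (0 ∷ is ++ z ∷ x ∷ []) * ((y + z) C (2 * x))) (incSeqs L 0 z))
      ≡⟨ sumL-*ʳ _ _ (incSeqs L 0 z) ⟩
    chainSum L z x * ((y + z) C (2 * x))
      ≡⟨ cong (_* ((y + z) C (2 * x))) (chainSum≡chainRec L z x) ⟩
    chainRec (suc L) z x * ((y + z) C (2 * x)) ∎

-- Forest statistics.  A forest is a List Tree; its vertices are counted by
-- edgesL, its leaves by leavesL, and its inner (non-leaf) vertices by inner.

leaf : Tree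
leaf = node []

inner : List Tree → ℕ
inner []                   = 0
inner (node [] ∷ ts)       = inner ts
inner (node (c ∷ cs) ∷ ts) = suc (inner (c ∷ cs) + inner ts)

edges≡leaves+inner : ∀ ts → edgesL ts ≡ leavesL ts + inner ts
edges≡leaves+inner []                   = refl
edges≡leaves+inner (node [] ∷ ts)       = cong suc (edges≡leaves+inner ts)
edges≡leaves+inner (node (c ∷ cs) ∷ ts) =
  trans (cong₂ (λ a b → suc a + b) (edges≡leaves+inner (c ∷ cs)) (edges≡leaves+inner ts))
        (rearrange (leavesL (c ∷ cs)) (inner (c ∷ cs)) (leavesL ts) (inner ts))
  where
  open +-*-Solver
  rearrange : ∀ a b c d → suc (a + b) + (c + d) ≡ (a + c) + suc (b + d)
  rearrange = solve 4 (λ a b c d → (con 1 :+ (a :+ b)) :+ (c :+ d) := (a :+ c) :+ (con 1 :+ (b :+ d))) refl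

leavesL-++ : ∀ xs ys → leavesL (xs ++ ys) ≡ leavesL xs + leavesL ys
leavesL-++ []       ys = refl
leavesL-++ (x ∷ xs) ys = trans (cong (leaves x +_) (leavesL-++ xs ys)) (sym (+-assoc (leaves x) _ _))

heightL-++ : ∀ xs ys → heightL (xs ++ ys) ≡ heightL xs ⊔ heightL ys
heightL-++ []       ys = refl
heightL-++ (x ∷ xs) ys = trans (cong (suc (height x) ⊔_) (heightL-++ xs ys)) (sym (⊔-assoc (suc (height x)) (heightL xs) (heightL ys)))

leavesL-replicate : ∀ c → leavesL (replicate c leaf) ≡ c
leavesL-replicate zero    = refl
leavesL-replicate (suc c) = cong suc (leavesL-replicate c)

inner-replicate : ∀ c F → inner (replicate c leaf ++ F) ≡ inner F
inner-replicate zero    F = refl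
inner-replicate (suc c) F = inner-replicate c F

heightL-replicate : ∀ c → heightL (replicate c leaf) ≤ 1
heightL-replicate zero    = z≤n
heightL-replicate (suc c) = ⊔-lub ≤-refl (heightL-replicate c)

NonEmpty : List Tree → Set
NonEmpty []      = ⊥
NonEmpty (_ ∷ _) = ⊤

NonEmpty-++ : ∀ xs y ys → NonEmpty (xs ++ y ∷ ys)
NonEmpty-++ []       y ys = tt
NonEmpty-++ (x ∷ xs) y ys = tt

inner-node : ∀ u U → NonEmpty u → inner (node u ∷ U) ≡ suc (inner u + inner U)
inner-node (x ∷ u) U _ = refl

leaves-node : ∀ u → NonEmpty u → leaves (node u) ≡ leavesL u
leaves-node (x ∷ u) _ = refl

-- The gaps
-- of a forest G, listed by `gaps G`, are the places where leaves can be put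
-- back: one before each tree, the gaps below each vertex, and one at the end.
-- Below a childless vertex of G there is a single gap, marked true: it must
-- receive a leaf, for that vertex was inner before pruning.

prune : List Tree → List Tree
prune []                   = []
prune (node [] ∷ ts)       = prune ts
prune (node (c ∷ cs) ∷ ts) = node (prune (c ∷ cs)) ∷ prune ts

mutual
  gaps : List Tree → List Bool
  gaps []           = false ∷ []
  gaps (node g ∷ G) = false ∷ (gapsBelow g ++ gaps G)

  gapsBelow : List Tree → List Bool
  gapsBelow []       = true ∷ []
  gapsBelow (x ∷ xs) = gaps (x ∷ xs)

length-gapsBelow : ∀ g → length (gapsBelow g) ≡ length (gaps g)
length-gapsBelow []      = refl
length-gapsBelow (x ∷ g) = refl

graft : List Tree → List ℕ → List Tree
graft []           []       = []
graft []           (c ∷ _)  = replicate c leaf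
graft (node g ∷ G) []       = []
graft (node g ∷ G) (c ∷ cs) =
  replicate c leaf ++ node (graft g (take (length (gapsBelow g)) cs)) ∷ graft G (drop (length (gapsBelow g)) cs)

-- leafCounts c F lists the number of leaves of F in each gap of prune F,
-- where c leaves preceding F belong to the first gap
leafCounts : ℕ → List Tree → List ℕ
leafCounts c []                  = c ∷ []
leafCounts c (node [] ∷ F)       = leafCounts (suc c) F
leafCounts c (node (x ∷ xs) ∷ F) = c ∷ (leafCounts 0 (x ∷ xs) ++ leafCounts 0 F)

take-length-++ : (xs ys : List A) → ∀ n → n ≡ length xs → take n (xs ++ ys) ≡ xs
take-length-++ []       ys .0                   refl = refl
take-length-++ (x ∷ xs) ys .(suc (length xs)) refl = cong (x ∷_) (take-length-++ xs ys _ refl)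

drop-length-++ : (xs ys : List A) → ∀ n → n ≡ length xs → drop n (xs ++ ys) ≡ ys
drop-length-++ []       ys .0                   refl = refl
drop-length-++ (x ∷ xs) ys .(suc (length xs)) refl = drop-length-++ xs ys _ refl

Fits-++ : ∀ bs bs' cs cs' → Fits bs cs → Fits bs' cs' → Fits (bs ++ bs') (cs ++ cs')
Fits-++ []           bs' []       cs' _            fits' = fits'
Fits-++ (false ∷ bs) bs' (x ∷ cs) cs' fits         fits' = Fits-++ bs bs' cs cs' fits fits'
Fits-++ (true ∷ bs)  bs' (x ∷ cs) cs' (pos , fits) fits' = pos , Fits-++ bs bs' cs cs' fits fits'

Fits-split : ∀ bs bs' cs → Fits (bs ++ bs') cs → Fits bs (take (length bs) cs) × Fits bs' (drop (length bs) cs)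
Fits-split []           bs' cs       fits         = tt , fits
Fits-split (false ∷ bs) bs' (x ∷ cs) fits         = Fits-split bs bs' cs fits
Fits-split (true ∷ bs)  bs' (x ∷ cs) (pos , fits) with Fits-split bs bs' cs fits
... | front , back = (pos , front) , back

Fits-gapsBelow : ∀ g cs → Fits (gapsBelow g) cs → Fits (gaps g) cs
Fits-gapsBelow []      (x ∷ []) (_ , fits) = fits
Fits-gapsBelow (x ∷ g) cs       fits       = fits

replicate-snoc : ∀ c (x : A) F → replicate (suc c) x ++ F ≡ replicate c x ++ (x ∷ F)
replicate-snoc zero    x F = refl
replicate-snoc (suc c) x F = cong (x ∷_) (replicate-snoc c x F)

length-leafCounts : ∀ c F → length (leafCounts c F) ≡ length (gaps (prune F))
length-leafCounts c []                  = refl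
length-leafCounts c (node [] ∷ F)       = length-leafCounts (suc c) F
length-leafCounts c (node (x ∷ xs) ∷ F) = cong suc (begin
  length (leafCounts 0 (x ∷ xs) ++ leafCounts 0 F)
    ≡⟨ length-++ (leafCounts 0 (x ∷ xs)) ⟩
  length (leafCounts 0 (x ∷ xs)) + length (leafCounts 0 F)
    ≡⟨ cong₂ _+_ (trans (length-leafCounts 0 (x ∷ xs)) (sym (length-gapsBelow (prune (x ∷ xs)))))
                 (length-leafCounts 0 F) ⟩
  length (gapsBelow (prune (x ∷ xs))) + length (gaps (prune F))
    ≡⟨ sym (length-++ (gapsBelow (prune (x ∷ xs)))) ⟩
  length (gapsBelow (prune (x ∷ xs)) ++ gaps (prune F)) ∎)
  where open ≡-Reasoning

graft-leafCounts : ∀ c F → graft (prune F) (leafCounts c F) ≡ replicate c leaf ++ F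
graft-leafCounts c []                  = sym (++-identityʳ _)
graft-leafCounts c (node [] ∷ F)       = trans (graft-leafCounts (suc c) F) (replicate-snoc c leaf F)
graft-leafCounts c (node (x ∷ xs) ∷ F) =
  cong (replicate c leaf ++_) (cong₂ _∷_
    (cong node (trans (cong (graft (prune (x ∷ xs))) (take-length-++ (leafCounts 0 (x ∷ xs)) (leafCounts 0 F) _ sameLength))
                      (graft-leafCounts 0 (x ∷ xs))))
    (trans (cong (graft (prune F)) (drop-length-++ (leafCounts 0 (x ∷ xs)) (leafCounts 0 F) _ sameLength))
           (graft-leafCounts 0 F)))
  where
  sameLength : length (gapsBelow (prune (x ∷ xs))) ≡ length (leafCounts 0 (x ∷ xs))
  sameLength = trans (length-gapsBelow (prune (x ∷ xs))) (sym (length-leafCounts 0 (x ∷ xs)))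

leafCounts-allLeaves : ∀ c F → prune F ≡ [] → leafCounts c F ≡ (c + length F) ∷ []
leafCounts-allLeaves c []                  _  = cong (_∷ []) (sym (+-identityʳ c))
leafCounts-allLeaves c (node [] ∷ F)       eq = trans (leafCounts-allLeaves (suc c) F eq) (cong (_∷ []) (sym (+-suc c (length F))))
leafCounts-allLeaves c (node (x ∷ xs) ∷ F) ()

leafCounts-fits : ∀ c F → Fits (gaps (prune F)) (leafCounts c F)
leafCounts-fits c []                  = tt
leafCounts-fits c (node [] ∷ F)       = leafCounts-fits (suc c) F
leafCounts-fits c (node (x ∷ xs) ∷ F) =
  Fits-++ (gapsBelow (prune (x ∷ xs))) (gaps (prune F)) (leafCounts 0 (x ∷ xs)) (leafCounts 0 F)
          (below (prune (x ∷ xs)) refl (leafCounts-fits 0 (x ∷ xs))) (leafCounts-fits 0 F)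
  where
  -- below a vertex whose children are all leaves, the single gap holds them all
  below : ∀ g → prune (x ∷ xs) ≡ g → Fits (gaps (prune (x ∷ xs))) (leafCounts 0 (x ∷ xs)) →
          Fits (gapsBelow g) (leafCounts 0 (x ∷ xs))
  below []      eq _    rewrite leafCounts-allLeaves 0 (x ∷ xs) eq = s≤s z≤n , tt
  below (y ∷ g) eq fits = subst (λ g → Fits (gaps g) (leafCounts 0 (x ∷ xs))) eq fits

prune-replicate : ∀ c F → prune (replicate c leaf ++ F) ≡ prune F
prune-replicate zero    F = refl
prune-replicate (suc c) F = prune-replicate c F

leafCounts-replicate : ∀ a c F → leafCounts a (replicate c leaf ++ F) ≡ leafCounts (a + c) F
leafCounts-replicate a zero    F = cong (λ m → leafCounts m F) (sym (+-identityʳ a))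
leafCounts-replicate a (suc c) F = trans (leafCounts-replicate (suc a) c F) (cong (λ m → leafCounts m F) (sym (+-suc a c)))

prune-node : ∀ u U → NonEmpty u → prune (node u ∷ U) ≡ node (prune u) ∷ prune U
prune-node (x ∷ u) U _ = refl

leafCounts-node : ∀ a u U → NonEmpty u → leafCounts a (node u ∷ U) ≡ a ∷ (leafCounts 0 u ++ leafCounts 0 U)
leafCounts-node a (x ∷ u) U _ = refl

graft-below-nonEmpty : ∀ g cs → Fits (gapsBelow g) cs → NonEmpty (graft g cs)
graft-below-nonEmpty []           (suc c ∷ []) _ = tt
graft-below-nonEmpty (node g ∷ G) (c ∷ cs)     _ = NonEmpty-++ (replicate c leaf) _ _

prune-graft : ∀ G cs → Fits (gaps G) cs → prune (graft G cs) ≡ G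
prune-graft []           (c ∷ []) _    = trans (cong prune (sym (++-identityʳ (replicate c leaf)))) (prune-replicate c [])
prune-graft (node g ∷ G) (c ∷ cs) fits with Fits-split (gapsBelow g) (gaps G) cs fits
... | fitsBelow , fitsRest =
  trans (prune-replicate c _)
    (trans (prune-node _ _ (graft-below-nonEmpty g _ fitsBelow))
      (cong₂ _∷_ (cong node (pruneBelow g fitsBelow)) (prune-graft G _ fitsRest)))
  where
  pruneBelow : ∀ g → Fits (gapsBelow g) (take (length (gapsBelow g)) cs) → prune (graft g (take (length (gapsBelow g)) cs)) ≡ g
  pruneBelow []       fits' = prune-graft [] (take 1 cs) (Fits-gapsBelow [] (take 1 cs) fits')
  pruneBelow (x ∷ xs) fits' = prune-graft (x ∷ xs) _ fits'

leafCounts-graft : ∀ G cs → Fits (gaps G) cs → leafCounts 0 (graft G cs) ≡ cs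
leafCounts-graft []           (c ∷ []) _    = trans (cong (leafCounts 0) (sym (++-identityʳ (replicate c leaf)))) (leafCounts-replicate 0 c [])
leafCounts-graft (node g ∷ G) (c ∷ cs) fits with Fits-split (gapsBelow g) (gaps G) cs fits
... | fitsBelow , fitsRest =
  trans (leafCounts-replicate 0 c _)
    (trans (leafCounts-node c _ _ (graft-below-nonEmpty g _ fitsBelow))
      (cong (c ∷_) (trans (cong₂ _++_ (leafCounts-graft g _ (Fits-gapsBelow g _ fitsBelow)) (leafCounts-graft G _ fitsRest))
                          (take++drop≡id (length (gapsBelow g)) cs))))

leaves-graft : ∀ G cs → Fits (gaps G) cs → leavesL (graft G cs) ≡ sumL cs
leaves-graft []           (c ∷ []) _    = trans (leavesL-replicate c) (sym (+-identityʳ c))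
leaves-graft (node g ∷ G) (c ∷ cs) fits with Fits-split (gapsBelow g) (gaps G) cs fits
... | fitsBelow , fitsRest = begin
  leavesL (replicate c leaf ++ node below ∷ rest)
    ≡⟨ leavesL-++ (replicate c leaf) _ ⟩
  leavesL (replicate c leaf) + (leaves (node below) + leavesL rest)
    ≡⟨ cong₂ _+_ (leavesL-replicate c)
                 (cong₂ _+_ (trans (leaves-node _ (graft-below-nonEmpty g _ fitsBelow)) (leaves-graft g _ (Fits-gapsBelow g _ fitsBelow)))
                            (leaves-graft G _ fitsRest)) ⟩
  c + (sumL (take n cs) + sumL (drop n cs))
    ≡⟨ cong (c +_) (trans (sym (sumL-++ (take n cs) (drop n cs))) (cong sumL (take++drop≡id n cs))) ⟩
  c + sumL cs ∎
  where
  open ≡-Reasoning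
  n = length (gapsBelow g)
  below = graft g (take n cs)
  rest = graft G (drop n cs)

inner-graft : ∀ G cs → Fits (gaps G) cs → inner (graft G cs) ≡ edgesL G
inner-graft []           (c ∷ []) _    = trans (cong inner (sym (++-identityʳ (replicate c leaf)))) (inner-replicate c [])
inner-graft (node g ∷ G) (c ∷ cs) fits with Fits-split (gapsBelow g) (gaps G) cs fits
... | fitsBelow , fitsRest =
  trans (inner-replicate c _)
    (trans (inner-node _ _ (graft-below-nonEmpty g _ fitsBelow))
      (cong suc (cong₂ _+_ (inner-graft g _ (Fits-gapsBelow g _ fitsBelow)) (inner-graft G _ fitsRest))))

height-graft : ∀ G cs → Fits (gaps G) cs → heightL (graft G cs) ≤ suc (heightL G)
height-graft []           (c ∷ []) _    = heightL-replicate c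
height-graft (node g ∷ G) (c ∷ cs) fits with Fits-split (gapsBelow g) (gaps G) cs fits
... | fitsBelow , fitsRest =
  subst (_≤ suc (heightL (node g ∷ G))) (sym (heightL-++ (replicate c leaf) _))
    (⊔-lub (≤-trans (heightL-replicate c) (s≤s z≤n))
      (⊔-lub (s≤s (≤-trans (height-graft g _ (Fits-gapsBelow g _ fitsBelow)) (m≤m⊔n (suc (heightL g)) (heightL G))))
             (≤-trans (height-graft G _ fitsRest) (s≤s (m≤n⊔m (suc (heightL g)) (heightL G))))))

height-prune : ∀ F h → heightL F ≤ suc h → heightL (prune F) ≤ h
height-prune []                  h _  = z≤n
height-prune (node [] ∷ F)       h le = height-prune F h (≤-trans (m≤n⊔m 1 (heightL F)) le)
height-prune (node (x ∷ xs) ∷ F) h le =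
  ⊔-lub (firstTree h (≤-pred (≤-trans (m≤m⊔n (suc (heightL (x ∷ xs))) (heightL F)) le)))
        (height-prune F h (≤-trans (m≤n⊔m (suc (heightL (x ∷ xs))) (heightL F)) le))
  where
  firstTree : ∀ h → heightL (x ∷ xs) ≤ h → suc (heightL (prune (x ∷ xs))) ≤ h
  firstTree zero     le' with ≤-trans (m≤m⊔n (suc (height x)) (heightL xs)) le'
  ... | ()
  firstTree (suc h') le' = s≤s (height-prune (x ∷ xs) h' le')

zeroable-++ : ∀ bs bs' → zeroable (bs ++ bs') ≡ zeroable bs + zeroable bs'
zeroable-++ []           bs' = refl
zeroable-++ (false ∷ bs) bs' = cong suc (zeroable-++ bs bs')
zeroable-++ (true ∷ bs)  bs' = zeroable-++ bs bs'

zeroable-gaps : ∀ G → zeroable (gaps G) ≡ suc (edgesL G + inner G)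
zeroable-gaps []                   = refl
zeroable-gaps (node [] ∷ G)        = cong suc (zeroable-gaps G)
zeroable-gaps (node (x ∷ xs) ∷ G)  =
  cong suc (trans (zeroable-++ (gaps (x ∷ xs)) (gaps G))
             (trans (cong₂ _+_ (zeroable-gaps (x ∷ xs)) (zeroable-gaps G))
                    (rearrange (edgesL (x ∷ xs)) (edgesL G) (inner (x ∷ xs)) (inner G))))
  where
  open +-*-Solver
  rearrange : ∀ a b c d → suc (a + c) + suc (b + d) ≡ suc a + b + suc (c + d)
  rearrange = solve 4 (λ a b c d → (con 1 :+ (a :+ c)) :+ (con 1 :+ (b :+ d)) := (con 1 :+ a) :+ b :+ (con 1 :+ (c :+ d))) refl

length-gaps : ∀ G → length (gaps G) ≡ suc (edgesL G + edgesL G)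
length-gaps []                  = refl
length-gaps (node [] ∷ G)       = cong (λ m → suc (suc m)) (trans (length-gaps G) (sym (+-suc (edgesL G) (edgesL G))))
length-gaps (node (x ∷ xs) ∷ G) =
  cong suc (trans (length-++ (gaps (x ∷ xs))) (trans (cong₂ _+_ (length-gaps (x ∷ xs)) (length-gaps G))
                                                   (rearrange (edgesL (x ∷ xs)) (edgesL G))))
  where
  open +-*-Solver
  rearrange : ∀ a b → suc (a + a) + suc (b + b) ≡ (suc a + b) + (suc a + b)
  rearrange = solve 2 (λ a b → (con 1 :+ (a :+ a)) :+ (con 1 :+ (b :+ b)) := ((con 1 :+ a) :+ b) :+ ((con 1 :+ a) :+ b)) refl

graftings : ℕ → List Tree → List (List Tree)
graftings j G = map (graft G) (compositions (gaps G) j)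

length-graftings : ∀ G j a w → edgesL G ≡ a → inner G ≡ w → length (graftings j G) ≡ (j + a + w) C (2 * a)
length-graftings G j a w size innerG = begin
  length (map (graft G) (compositions (gaps G) j))
    ≡⟨ length-map (graft G) (compositions (gaps G) j) ⟩
  length (compositions (gaps G) j)
    ≡⟨ length-compositions (gaps G) j ⟩
  posComps (j + zeroable (gaps G)) (length (gaps G))
    ≡⟨ cong₂ posComps (trans (cong (j +_) (zeroable-gaps G)) (+-suc j _)) (length-gaps G) ⟩
  posComps (suc (j + (edgesL G + inner G))) (suc (edgesL G + edgesL G))
    ≡⟨ posComps≡C (j + (edgesL G + inner G)) (edgesL G + edgesL G) ⟩
  (j + (edgesL G + inner G)) C (edgesL G + edgesL G)
    ≡⟨ cong₂ (λ e i → (j + (e + i)) C (e + e)) size innerG ⟩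
  (j + (a + w)) C (a + a)
    ≡⟨ cong₂ _C_ (sym (+-assoc j a w)) (cong (a +_) (sym (+-identityʳ a))) ⟩
  (j + a + w) C (2 * a) ∎
  where open ≡-Reasoning

-- Enumerating forests.  forests h j a lists the forests of height ≤ h with j
-- leaves and a inner vertices: for h + 1 these are the graftings of j leaves
-- onto the forests of height ≤ h with a vertices, w of them inner.

ForestP : ℕ → ℕ → ℕ → List Tree → Set
ForestP h j a F = heightL F ≤ h × leavesL F ≡ j × inner F ≡ a

forests : ℕ → ℕ → ℕ → List (List Tree)
forests zero    zero    zero    = [ [] ]
forests zero    zero    (suc a) = []
forests zero    (suc j) a       = []
forests (suc h) j       a       = concatMap (λ w → concatMap (graftings j) (forests h (a ∸ w) w)) (range 0 a)

split-range : ∀ {a w} → w ∈ range 0 a → a ∸ w + w ≡ a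
split-range {a} w∈ = m∸n+n≡m (proj₂ (∈-range⁻ {0} {a} w∈))

forests-sound : ∀ h j a F → F ∈ forests h j a → ForestP h j a F
forests-sound zero    zero zero .[] (here refl) = z≤n , refl , refl
forests-sound (suc h) j    a F   F∈ with ∈-concatMap⁻ _ (range 0 a) F∈
... | w , w∈ , F∈₁ with ∈-concatMap⁻ (graftings j) (forests h (a ∸ w) w) F∈₁
... | G , G∈ , F∈₂ with ∈-map⁻ (graft G) F∈₂
... | c , c∈ , refl with All.lookup (compositions-sound (gaps G) j) c∈ | forests-sound h (a ∸ w) w G G∈
... | fits , sum | heightG , leavesG , innerG =
  ≤-trans (height-graft G c fits) (s≤s heightG) ,
  trans (leaves-graft G c fits) sum ,
  trans (inner-graft G c fits) (trans (edges≡leaves+inner G) (trans (cong₂ _+_ leavesG innerG) (split-range w∈)))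

height0⇒empty : ∀ F → heightL F ≤ 0 → F ≡ []
height0⇒empty []      _  = refl
height0⇒empty (t ∷ F) le with ≤-trans (m≤m⊔n (suc (height t)) (heightL F)) le
... | ()

-- every forest is the grafting of its leaf counts onto its pruning
forests-complete : ∀ h j a F → ForestP h j a F → F ∈ forests h j a
forests-complete zero j a F (heightF , _ , _) with height0⇒empty F heightF
forests-complete zero .0 .0 .[] (_ , refl , refl) | refl = here refl
forests-complete (suc h) j a F (heightF , leavesF , innerF) =
  ∈-concatMap⁺ {f = λ w → concatMap (graftings j) (forests h (a ∸ w) w)} w∈
    (∈-concatMap⁺ {f = graftings j} G∈
      (subst (_∈ graftings j G) regraft (∈-map⁺ (graft G) (compositions-complete (gaps G) j c (fits , sum)))))
  where
  G = prune F
  c = leafCounts 0 F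
  w = inner G
  regraft : graft G c ≡ F
  regraft = graft-leafCounts 0 F
  fits : Fits (gaps G) c
  fits = leafCounts-fits 0 F
  sum : sumL c ≡ j
  sum = trans (sym (leaves-graft G c fits)) (trans (cong leavesL regraft) leavesF)
  sizeG : leavesL G + w ≡ a
  sizeG = trans (sym (edges≡leaves+inner G)) (trans (sym (inner-graft G c fits)) (trans (cong inner regraft) innerF))
  w∈ : w ∈ range 0 a
  w∈ = ∈-range⁺ z≤n (subst (w ≤_) sizeG (m≤n+m w (leavesL G)))
  G∈ : G ∈ forests h (a ∸ w) w
  G∈ = forests-complete h (a ∸ w) w G
         (height-prune F h heightF , trans (sym (m+n∸n≡m (leavesL G) w)) (cong (_∸ w) sizeG) , refl)

-- distinct members are told apart by the number of inner vertices of the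
-- pruning, then by the pruning, then by the leaf counts
forests-unique : ∀ h j a → Unique (forests h j a)
forests-unique zero    zero    zero    = [] ∷ []
forests-unique zero    zero    (suc a) = []
forests-unique zero    (suc j) a       = []
forests-unique (suc h) j       a       =
  Unique-concatMap (λ w → concatMap (graftings j) (forests h (a ∸ w) w)) (λ F → inner (prune F)) (range 0 a) (range-unique 0 a)
    (λ w _ → Unique-concatMap (graftings j) prune (forests h (a ∸ w) w) (forests-unique h (a ∸ w) w)
               (λ G _ → Unique-map (graft G) (compositions (gaps G) j) (graft-injective G) (compositions-unique (gaps G) j))
               (λ G F _ F∈ → pruning G F F∈))
    innerOfPruning
  where
  fitsOf : ∀ G {c} → c ∈ compositions (gaps G) j → Fits (gaps G) c
  fitsOf G c∈ = proj₁ (All.lookup (compositions-sound (gaps G) j) c∈)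
  graft-injective : ∀ G {c d} → c ∈ compositions (gaps G) j → d ∈ compositions (gaps G) j → graft G c ≡ graft G d → c ≡ d
  graft-injective G {c} {d} c∈ d∈ eq =
    trans (sym (leafCounts-graft G c (fitsOf G c∈))) (trans (cong (leafCounts 0) eq) (leafCounts-graft G d (fitsOf G d∈)))
  pruning : ∀ G F → F ∈ graftings j G → prune F ≡ G
  pruning G F F∈ with ∈-map⁻ (graft G) F∈
  ... | c , c∈ , refl = prune-graft G c (fitsOf G c∈)
  innerOfPruning : ∀ w F → w ∈ range 0 a → F ∈ concatMap (graftings j) (forests h (a ∸ w) w) → inner (prune F) ≡ w
  innerOfPruning w F _ F∈ with ∈-concatMap⁻ (graftings j) (forests h (a ∸ w) w) F∈
  ... | G , G∈ , F∈G = trans (cong inner (pruning G F F∈G)) (proj₂ (proj₂ (forests-sound h (a ∸ w) w G G∈)))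

forests-HasCard : ∀ h j a → HasCard (List Tree) (ForestP h j a) (length (forests h j a))
forests-HasCard h j a =
  forests h j a , forests-unique h j a , refl , λ F → mk⇔ (forests-sound h j a F) (forests-complete h j a F)

length-forests-suc : ∀ h j a → length (forests (suc h) j a) ≡
  sumL (map (λ w → length (forests h (a ∸ w) w) * ((j + a + w) C (2 * a))) (range 0 a))
length-forests-suc h j a = begin
  length (concatMap (λ w → concatMap (graftings j) (forests h (a ∸ w) w)) (range 0 a))
    ≡⟨ length-concatMap (λ w → concatMap (graftings j) (forests h (a ∸ w) w)) (range 0 a) ⟩
  sumL (map (λ w → length (concatMap (graftings j) (forests h (a ∸ w) w))) (range 0 a))
    ≡⟨ sumL-cong _ _ (range 0 a) skeletonsWith ⟩
  sumL (map (λ w → length (forests h (a ∸ w) w) * ((j + a + w) C (2 * a))) (range 0 a)) ∎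
  where
  open ≡-Reasoning
  skeletonsWith : ∀ w → w ∈ range 0 a →
    length (concatMap (graftings j) (forests h (a ∸ w) w)) ≡ length (forests h (a ∸ w) w) * ((j + a + w) C (2 * a))
  skeletonsWith w w∈ = begin
    length (concatMap (graftings j) (forests h (a ∸ w) w))
      ≡⟨ length-concatMap (graftings j) (forests h (a ∸ w) w) ⟩
    sumL (map (λ G → length (graftings j G)) (forests h (a ∸ w) w))
      ≡⟨ sumL-cong _ _ (forests h (a ∸ w) w) graftingsOf ⟩
    sumL (map (λ _ → (j + a + w) C (2 * a)) (forests h (a ∸ w) w))
      ≡⟨ sumL-const ((j + a + w) C (2 * a)) (forests h (a ∸ w) w) ⟩
    length (forests h (a ∸ w) w) * ((j + a + w) C (2 * a)) ∎
    where
    graftingsOf : ∀ G → G ∈ forests h (a ∸ w) w → length (graftings j G) ≡ (j + a + w) C (2 * a)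
    graftingsOf G G∈ with forests-sound h (a ∸ w) w G G∈
    ... | _ , leavesG , innerG =
      length-graftings G j a w (trans (edges≡leaves+inner G) (trans (cong₂ _+_ leavesG innerG) (split-range w∈))) innerG

length-forests : ∀ h j a → length (forests (suc h) j a) ≡ chainRec h a (j + a)
length-forests zero j zero =
  trans (length-forests-suc zero j zero) (trans (+-identityʳ _) (trans (*-identityˡ _) (nC0≡1 (j + 0 + 0))))
length-forests zero j (suc a) =
  trans (length-forests-suc zero j (suc a))
    (sumL-zero _ (range 0 (suc a)) (λ w w∈ → cong (_* ((j + suc a + w) C (2 * suc a))) (noForest (suc a ∸ w) w (split-range w∈))))
  where
  noForest : ∀ x w → x + w ≡ suc a → length (forests zero x w) ≡ 0
  noForest zero    zero    ()
  noForest zero    (suc w) _ = refl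
  noForest (suc x) w       _ = refl
length-forests (suc h) j a =
  trans (length-forests-suc (suc h) j a)
    (sumL-cong _ _ (range 0 a) (λ w w∈ → cong (_* ((j + a + w) C (2 * a)))
      (trans (length-forests h (a ∸ w) w) (cong (chainRec h w) (split-range w∈)))))

edgesL≡0⇒empty : ∀ ts → edgesL ts ≡ 0 → ts ≡ []
edgesL≡0⇒empty []      _ = refl
edgesL≡0⇒empty (t ∷ ts) ()

node-injective : ∀ {ts us} → node ts ≡ node us → ts ≡ us
node-injective refl = refl

node-into : ∀ n j k → j ≤ n → ∀ ts → ForestP k j (n ∸ j) ts → TreeP n j k (node ts)
node-into zero    .0 k z≤n ts (_ , leavesF , innerF) = trans (edges≡leaves+inner ts) (cong₂ _+_ leavesF innerF) , refl
node-into (suc n) j  k j≤n [] (_ , leavesF , innerF) with trans (sym (m+[n∸m]≡n j≤n)) (cong₂ _+_ (sym leavesF) (sym innerF))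
... | ()
node-into (suc n) j  k j≤n (t ∷ ts) (heightF , leavesF , innerF) =
  trans (edges≡leaves+inner (t ∷ ts)) (trans (cong₂ _+_ leavesF innerF) (m+[n∸m]≡n j≤n)) , leavesF , heightF

node-onto : ∀ n j k → j ≤ n → ∀ t → TreeP n j k t → ∃[ ts ] (ForestP k j (n ∸ j) ts × node ts ≡ t)
node-onto zero    .0 k z≤n (node ts) (noEdges , refl) rewrite edgesL≡0⇒empty ts noEdges = [] , (z≤n , refl , refl) , refl
node-onto (suc n) j  k j≤n (node [])       (() , _)
node-onto (suc n) j  k j≤n (node (t ∷ ts)) (size , leavesT , heightT) = t ∷ ts , (heightT , leavesT , innerT) , refl
  where
  innerT : inner (t ∷ ts) ≡ suc n ∸ j
  innerT = trans (sym (m+n∸m≡n (leavesL (t ∷ ts)) (inner (t ∷ ts))))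
                 (trans (cong (_∸ leavesL (t ∷ ts)) (sym (edges≡leaves+inner (t ∷ ts)))) (cong₂ _∸_ size leavesT))

trees-HasCard : ∀ n j k → j ≤ n → HasCard Tree (TreeP n j k) (length (forests k j (n ∸ j)))
trees-HasCard n j k j≤n = HasCard-bij node (λ _ _ → node-injective) (node-into n j k j≤n) (node-onto n j k j≤n) (forests-HasCard k j (n ∸ j))

length-forests≡binomSum : ∀ n j k → j ≤ n → 2 ≤ k → length (forests k j (n ∸ j)) ≡ binomSum n j k
length-forests≡binomSum n j (suc zero)    j≤n (s≤s ())
length-forests≡binomSum n j (suc (suc k)) j≤n _ = begin
  length (forests (suc (suc k)) j (n ∸ j))     ≡⟨ length-forests (suc k) j (n ∸ j) ⟩
  chainRec (suc k) (n ∸ j) (j + (n ∸ j))       ≡⟨ sym (chainSum≡chainRec k (n ∸ j) (j + (n ∸ j))) ⟩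
  chainSum k (n ∸ j) (j + (n ∸ j))             ≡⟨ cong (chainSum k (n ∸ j)) (m+[n∸m]≡n j≤n) ⟩
  chainSum k (n ∸ j) n                         ∎
  where open ≡-Reasoning

-- The word of a forest whose first tree has
-- subforest cs is  v · word cs · (word of the other trees shifted by v + 1)
-- with v = edgesL cs; the root of the first tree is the entry v, and it is
-- followed by the smaller entries of its subforest and then by larger ones.

shift : ℕ → List ℕ → List ℕ
shift c = map (c +_)

word : List Tree → List ℕ
word []             = []
word (node cs ∷ ts) = edgesL cs ∷ (word cs ++ shift (suc (edgesL cs)) (word ts))

-- x followed by l starts no 231 pattern: no entries l_b > x > l_c with b < c
Avoids231From : ℕ → List ℕ → Set
Avoids231From x []      = ⊤
Avoids231From x (y ∷ l) = (x < y → All (x ≤_) l) × Avoids231From x l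

Avoids231L : List ℕ → Set
Avoids231L []      = ⊤
Avoids231L (x ∷ l) = Avoids231From x l × Avoids231L l

-- the entry at position o + i of the word l satisfies o + i < lᵢ + h
DropBound : ℕ → ℕ → List ℕ → Set
DropBound o h []      = ⊤
DropBound o h (y ∷ l) = o < y + h × DropBound (suc o) h l

Covers : ℕ → List ℕ → Set
Covers n l = ∀ y → y < n → y ∈ l

IsPermWord : ℕ → List ℕ → Set
IsPermWord n l = Unique l × All (_< n) l × Covers n l

All-shift : ∀ {P : ℕ → Set} c l → All (λ y → P (c + y)) l → All P (shift c l)
All-shift c l ps = All.map⁺ ps

shift-injective : ∀ c l l' → shift c l ≡ shift c l' → l ≡ l'
shift-injective c []      []        eq = refl
shift-injective c (x ∷ l) (x' ∷ l') eq with ∷-injective eq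
... | head , tail = cong₂ _∷_ (+-cancelˡ-≡ c x x' head) (shift-injective c l l' tail)

length-word : ∀ F → length (word F) ≡ edgesL F
length-word []             = refl
length-word (node cs ∷ ts) = cong suc (begin
  length (word cs ++ shift (suc (edgesL cs)) (word ts))
    ≡⟨ length-++ (word cs) ⟩
  length (word cs) + length (shift (suc (edgesL cs)) (word ts))
    ≡⟨ cong₂ _+_ (length-word cs) (trans (length-map (suc (edgesL cs) +_) (word ts)) (length-word ts)) ⟩
  edgesL cs + edgesL ts ∎)
  where open ≡-Reasoning

word-bound : ∀ F → All (_< edgesL F) (word F)
word-bound []             = []
word-bound (node cs ∷ ts) =
  s≤s (m≤m+n v (edgesL ts)) ∷
  All.++⁺ (All.map (λ y<v → ≤-trans y<v (≤-trans (n≤1+n v) (s≤s (m≤m+n v (edgesL ts))))) (word-bound cs))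
          (All-shift (suc v) (word ts) (All.map (+-monoʳ-< (suc v)) (word-bound ts)))
  where v = edgesL cs

word-separated : ∀ cs ts → All (_< edgesL cs) (word cs) × All (edgesL cs <_) (shift (suc (edgesL cs)) (word ts))
word-separated cs ts = word-bound cs , All-shift (suc (edgesL cs)) (word ts) (All.tabulate (λ {y} _ → s≤s (m≤m+n (edgesL cs) y)))

word-unique : ∀ F → Unique (word F)
word-unique []             = []
word-unique (node cs ∷ ts) =
  All.tabulate rootFresh ∷
  Unique.++⁺ (word-unique cs) (Unique.map⁺ (+-cancelˡ-≡ (suc v) _ _) (word-unique ts))
             (λ (y∈cs , y∈ts) → <-asym (All.lookup below y∈cs) (All.lookup above y∈ts))
  where
  v = edgesL cs
  below = proj₁ (word-separated cs ts)
  above = proj₂ (word-separated cs ts)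
  rootFresh : ∀ {y} → y ∈ word cs ++ shift (suc v) (word ts) → v ≢ y
  rootFresh y∈ refl with ∈-++⁻ (word cs) y∈
  ... | inj₁ p = <-irrefl refl (All.lookup below p)
  ... | inj₂ p = <-irrefl refl (All.lookup above p)

word-covers : ∀ F → Covers (edgesL F) (word F)
word-covers (node cs ∷ ts) y y<n with <-cmp y (edgesL cs)
... | tri< y<v _ _ = there (∈-++⁺ˡ (word-covers cs y y<v))
... | tri≈ _ refl _ = here refl
... | tri> _ _ v<y = there (∈-++⁺ʳ (word cs) (subst (_∈ shift (suc (edgesL cs)) (word ts)) (m+[n∸m]≡n v<y)
        (∈-map⁺ (suc (edgesL cs) +_) (word-covers ts (y ∸ suc (edgesL cs)) inRest))))
  where
  inRest : y ∸ suc (edgesL cs) < edgesL ts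
  inRest = +-cancelˡ-< (suc (edgesL cs)) _ _ (subst (_< suc (edgesL cs) + edgesL ts) (sym (m+[n∸m]≡n v<y)) y<n)

word-isPermWord : ∀ F → IsPermWord (edgesL F) (word F)
word-isPermWord F = word-unique F , word-bound F , word-covers F

++-injective-length : ∀ (xs xs' ys ys' : List ℕ) → length xs ≡ length xs' → xs ++ ys ≡ xs' ++ ys' → xs ≡ xs' × ys ≡ ys'
++-injective-length []       []         ys ys' _   eq = refl , eq
++-injective-length (x ∷ xs) (x' ∷ xs') ys ys' len eq with ∷-injective eq
... | refl , eq' with ++-injective-length xs xs' ys ys' (suc-injective len) eq'
...   | refl , rest = refl , rest

word-injective : ∀ F F' → word F ≡ word F' → F ≡ F'
word-injective []             []               eq = refl
word-injective []             (node _ ∷ _)     ()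
word-injective (node _ ∷ _)   []               ()
word-injective (node cs ∷ ts) (node cs' ∷ ts') eq with ∷-injective eq
... | root , rest
  with ++-injective-length (word cs) (word cs') _ _ (trans (length-word cs) (trans root (sym (length-word cs')))) rest
...   | first , others rewrite root =
  cong₂ (λ us vs → node us ∷ vs) (word-injective cs cs' first)
        (word-injective ts ts' (shift-injective (suc (edgesL cs')) (word ts) (word ts') others))

Avoids231From-above : ∀ x ys → All (x <_) ys → Avoids231From x ys
Avoids231From-above x []       _          = tt
Avoids231From-above x (y ∷ ys) (_ ∷ x<ys) = (λ _ → All.map <⇒≤ x<ys) , Avoids231From-above x ys x<ys

Avoids231From-below : ∀ x ys → All (_< x) ys → Avoids231From x ys
Avoids231From-below x []       _           = tt
Avoids231From-below x (y ∷ ys) (y<x ∷ ys<x) = (λ x<y → ⊥-elim (<-asym y<x x<y)) , Avoids231From-below x ys ys<x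

Avoids231From-++ : ∀ x xs ys → Avoids231From x xs → All (x <_) ys → Avoids231From x (xs ++ ys)
Avoids231From-++ x []       ys _              x<ys = Avoids231From-above x ys x<ys
Avoids231From-++ x (y ∷ xs) ys (after , rest) x<ys =
  (λ x<y → All.++⁺ (after x<y) (All.map <⇒≤ x<ys)) , Avoids231From-++ x xs ys rest x<ys

Avoids231L-++ : ∀ xs ys → Avoids231L xs → Avoids231L ys → All (λ x → All (x <_) ys) xs → Avoids231L (xs ++ ys)
Avoids231L-++ []       ys _              avoidsYs _            = avoidsYs
Avoids231L-++ (x ∷ xs) ys (from , avoids) avoidsYs (x<ys ∷ below) =
  Avoids231From-++ x xs ys from x<ys , Avoids231L-++ xs ys avoids avoidsYs below

Avoids231From-shift : ∀ c x l → Avoids231From x l → Avoids231From (c + x) (shift c l)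
Avoids231From-shift c x []      _              = tt
Avoids231From-shift c x (y ∷ l) (after , rest) =
  (λ lt → All-shift c l (All.map (+-monoʳ-≤ c) (after (+-cancelˡ-< c _ _ lt)))) , Avoids231From-shift c x l rest

Avoids231L-shift : ∀ c l → Avoids231L l → Avoids231L (shift c l)
Avoids231L-shift c []      _               = tt
Avoids231L-shift c (x ∷ l) (from , avoids) = Avoids231From-shift c x l from , Avoids231L-shift c l avoids

Avoids231From-unshift : ∀ c x l → Avoids231From (c + x) (shift c l) → Avoids231From x l
Avoids231From-unshift c x []      _              = tt
Avoids231From-unshift c x (y ∷ l) (after , rest) =
  (λ x<y → All.map (+-cancelˡ-≤ c _ _) (All.map⁻ (after (+-monoʳ-< c x<y)))) , Avoids231From-unshift c x l rest

Avoids231L-unshift : ∀ c l → Avoids231L (shift c l) → Avoids231L l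
Avoids231L-unshift c []      _               = tt
Avoids231L-unshift c (x ∷ l) (from , avoids) = Avoids231From-unshift c x l from , Avoids231L-unshift c l avoids

Avoids231From-prefix : ∀ x xs ys → Avoids231From x (xs ++ ys) → Avoids231From x xs
Avoids231From-prefix x []       ys _              = tt
Avoids231From-prefix x (y ∷ xs) ys (after , rest) = (λ x<y → All.++⁻ˡ xs (after x<y)) , Avoids231From-prefix x xs ys rest

Avoids231From-suffix : ∀ x xs ys → Avoids231From x (xs ++ ys) → Avoids231From x ys
Avoids231From-suffix x []       ys from         = from
Avoids231From-suffix x (y ∷ xs) ys (_ , rest)   = Avoids231From-suffix x xs ys rest

Avoids231L-prefix : ∀ xs ys → Avoids231L (xs ++ ys) → Avoids231L xs
Avoids231L-prefix []       ys _               = tt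
Avoids231L-prefix (x ∷ xs) ys (from , avoids) = Avoids231From-prefix x xs ys from , Avoids231L-prefix xs ys avoids

Avoids231L-suffix : ∀ xs ys → Avoids231L (xs ++ ys) → Avoids231L ys
Avoids231L-suffix []       ys avoids     = avoids
Avoids231L-suffix (x ∷ xs) ys (_ , avoids) = Avoids231L-suffix xs ys avoids

word-avoids231 : ∀ F → Avoids231L (word F)
word-avoids231 []             = tt
word-avoids231 (node cs ∷ ts) =
  Avoids231From-++ v (word cs) (shift (suc v) (word ts)) (Avoids231From-below v (word cs) below) above ,
  Avoids231L-++ (word cs) (shift (suc v) (word ts)) (word-avoids231 cs) (Avoids231L-shift (suc v) (word ts) (word-avoids231 ts))
                (All.map (λ y<v → All.map (<-trans y<v) above) below)
  where
  v = edgesL cs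
  below = proj₁ (word-separated cs ts)
  above = proj₂ (word-separated cs ts)

-- Descents of words: shifting keeps them, a low block followed by a high
-- block has no descent at the junction, and the descents of word F are
-- exactly its inner vertices (an inner vertex v is followed by its first child).

descent : ℕ → ℕ → ℕ
descent x y = if does (suc y ≤? x) then 1 else 0

descent-shift : ∀ c x y → descent (c + x) (c + y) ≡ descent x y
descent-shift c x y = cong (λ b → if b then 1 else 0) sameTest
  where
  sameTest : does (suc (c + y) ≤? (c + x)) ≡ does (suc y ≤? x)
  sameTest with suc y ≤? x
  ... | yes y<x = trans (dec-true (suc (c + y) ≤? (c + x)) (subst (_≤ c + x) (+-suc c y) (+-monoʳ-≤ c y<x)))
                        (sym (dec-true (suc y ≤? x) y<x))
  ... | no  y≮x = trans (dec-false (suc (c + y) ≤? (c + x)) (λ lt → y≮x (+-cancelˡ-≤ c _ _ (subst (_≤ c + x) (sym (+-suc c y)) lt))))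
                        (sym (dec-false (suc y ≤? x) y≮x))

desL-shift : ∀ c l → desL (shift c l) ≡ desL l
desL-shift c []          = refl
desL-shift c (x ∷ [])    = refl
desL-shift c (x ∷ y ∷ l) = cong₂ _+_ (descent-shift c x y) (desL-shift c (y ∷ l))

desL-++ : ∀ m xs ys → All (_≤ m) xs → All (m <_) ys → desL (xs ++ ys) ≡ desL xs + desL ys
desL-++ m []            ys       _            _          = refl
desL-++ m (x ∷ [])      []       _            _          = refl
desL-++ m (x ∷ [])      (y ∷ ys) (x≤m ∷ _)    (m<y ∷ _)  =
  cong (λ b → (if b then 1 else 0) + desL (y ∷ ys)) (dec-false (suc y ≤? x) (λ y<x → <-asym (≤-trans y<x x≤m) m<y))
desL-++ m (x ∷ x' ∷ xs) ys       (_ ∷ xs≤m)   m<ys       =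
  trans (cong (descent x x' +_) (desL-++ m (x' ∷ xs) ys xs≤m m<ys)) (sym (+-assoc (descent x x') (desL (x' ∷ xs)) (desL ys)))

word-descents : ∀ F → desL (word F) ≡ inner F
word-descents []                        = refl
word-descents (node [] ∷ ts)            =
  trans (desL-++ 0 (0 ∷ []) (shift 1 (word ts)) (z≤n ∷ []) (All-shift 1 (word ts) (All.tabulate (λ _ → s≤s z≤n))))
        (trans (desL-shift 1 (word ts)) (word-descents ts))
word-descents (node (node xs ∷ cs) ∷ ts) =
  trans (desL-++ v (v ∷ word (node xs ∷ cs)) (shift (suc v) (word ts))
                   (≤-refl ∷ All.map <⇒≤ (proj₁ (word-separated (node xs ∷ cs) ts))) (proj₂ (word-separated (node xs ∷ cs) ts)))
    (cong₂ _+_ (trans (cong (_+ desL (word (node xs ∷ cs))) rootDescent) (cong suc (word-descents (node xs ∷ cs))))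
               (trans (desL-shift (suc v) (word ts)) (word-descents ts)))
  where
  v = edgesL (node xs ∷ cs)
  rootDescent : descent v (edgesL xs) ≡ 1
  rootDescent = cong (λ b → if b then 1 else 0) (dec-true (suc (edgesL xs) ≤? v) (s≤s (m≤m+n (edgesL xs) (edgesL cs))))

-- Drops of words: height ≤ h of F is equivalent to i < (word F)ᵢ + h for all i.
-- A vertex at depth d ≥ 1 sits at a position at most d − 1 past its value.

DropBound-++⁺ : ∀ o h xs ys → DropBound o h xs → DropBound (o + length xs) h ys → DropBound o h (xs ++ ys)
DropBound-++⁺ o h []       ys _            bys = subst (λ p → DropBound p h ys) (+-identityʳ o) bys
DropBound-++⁺ o h (x ∷ xs) ys (bx , bxs) bys =
  bx , DropBound-++⁺ (suc o) h xs ys bxs (subst (λ p → DropBound p h ys) (+-suc o (length xs)) bys)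

DropBound-++⁻ : ∀ o h xs ys → DropBound o h (xs ++ ys) → DropBound o h xs × DropBound (o + length xs) h ys
DropBound-++⁻ o h []       ys bys        = tt , subst (λ p → DropBound p h ys) (sym (+-identityʳ o)) bys
DropBound-++⁻ o h (x ∷ xs) ys (bx , rest) with DropBound-++⁻ (suc o) h xs ys rest
... | bxs , bys = (bx , bxs) , subst (λ p → DropBound p h ys) (sym (+-suc o (length xs))) bys

DropBound-suc⁺ : ∀ o h l → DropBound o h l → DropBound (suc o) (suc h) l
DropBound-suc⁺ o h []      _          = tt
DropBound-suc⁺ o h (y ∷ l) (by , bl) = subst (suc o <_) (sym (+-suc y h)) (s≤s by) , DropBound-suc⁺ (suc o) h l bl

DropBound-suc⁻ : ∀ o h l → DropBound (suc o) (suc h) l → DropBound o h l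
DropBound-suc⁻ o h []      _          = tt
DropBound-suc⁻ o h (y ∷ l) (by , bl) = ≤-pred (subst (suc o <_) (+-suc y h) by) , DropBound-suc⁻ (suc o) h l bl

DropBound-shift⁺ : ∀ c o h l → DropBound o h l → DropBound (c + o) h (shift c l)
DropBound-shift⁺ c o h []      _          = tt
DropBound-shift⁺ c o h (y ∷ l) (by , bl) =
  subst (c + o <_) (sym (+-assoc c y h)) (+-monoʳ-< c by) ,
  subst (λ p → DropBound p h (shift c l)) (+-suc c o) (DropBound-shift⁺ c (suc o) h l bl)

DropBound-shift⁻ : ∀ c o h l → DropBound (c + o) h (shift c l) → DropBound o h l
DropBound-shift⁻ c o h []      _          = tt
DropBound-shift⁻ c o h (y ∷ l) (by , bl) =
  +-cancelˡ-< c _ _ (subst (c + o <_) (+-assoc c y h) by) ,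
  DropBound-shift⁻ c (suc o) h l (subst (λ p → DropBound p h (shift c l)) (sym (+-suc c o)) bl)

-- with h = 0 every entry would exceed its position, impossible when all entries
-- are below the position after the word
DropBound-zero : ∀ o y l → DropBound o 0 (y ∷ l) → All (_< o + length (y ∷ l)) (y ∷ l) → ⊥
DropBound-zero o y []       (by , _) (y< ∷ _) =
  <-irrefl refl (<-≤-trans (subst (o <_) (+-identityʳ y) by) (≤-pred (subst (y <_) (+-comm o 1) y<)))
DropBound-zero o y (y' ∷ l) (_ , bl) (_ ∷ l<) =
  DropBound-zero (suc o) y' l bl (All.map (λ {z} lt → subst (z <_) (+-suc o (suc (length l))) lt) l<)

restOffset : ∀ cs → suc (edgesL cs) + 0 ≡ 1 + length (word cs)
restOffset cs = trans (+-identityʳ (suc (edgesL cs))) (cong suc (sym (length-word cs)))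

word-dropBound : ∀ F h → heightL F ≤ h → DropBound 0 h (word F)
word-dropBound []             h       _  = tt
word-dropBound (node cs ∷ ts) zero    le with ≤-trans (m≤m⊔n (suc (heightL cs)) (heightL ts)) le
... | ()
word-dropBound (node cs ∷ ts) (suc h) le =
  subst (0 <_) (sym (+-suc (edgesL cs) h)) (s≤s z≤n) ,
  DropBound-++⁺ 1 (suc h) (word cs) (shift (suc v) (word ts))
    (DropBound-suc⁺ 0 h (word cs) (word-dropBound cs h (≤-pred (≤-trans (m≤m⊔n (suc (heightL cs)) (heightL ts)) le))))
    (subst (λ p → DropBound p (suc h) (shift (suc v) (word ts))) (restOffset cs)
       (DropBound-shift⁺ (suc v) 0 (suc h) (word ts) (word-dropBound ts (suc h) (≤-trans (m≤n⊔m (suc (heightL cs)) (heightL ts)) le))))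
  where v = edgesL cs

dropBound-height : ∀ F h → DropBound 0 h (word F) → heightL F ≤ h
dropBound-height []             h _           = z≤n
dropBound-height (node cs ∷ ts) h (broot , b) with DropBound-++⁻ 1 h (word cs) (shift (suc (edgesL cs)) (word ts)) b
... | bcs , bts =
  ⊔-lub (firstTree cs h broot bcs)
        (dropBound-height ts h (DropBound-shift⁻ (suc (edgesL cs)) 0 h (word ts)
          (subst (λ p → DropBound p h (shift (suc (edgesL cs)) (word ts))) (sym (restOffset cs)) bts)))
  where
  firstTree : ∀ cs h → 0 < edgesL cs + h → DropBound 1 h (word cs) → suc (heightL cs) ≤ h
  firstTree []              zero     ()  _
  firstTree (node xs ∷ cs') zero     _   b' =
    ⊥-elim (DropBound-zero 1 _ _ b' (All.map (λ lt → ≤-trans lt (≤-trans (≤-reflexive (sym (length-word (node xs ∷ cs')))) (n≤1+n _)))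
                                            (word-bound (node xs ∷ cs'))))
  firstTree cs              (suc h') _   b' = s≤s (dropBound-height cs h' (DropBound-suc⁻ 0 h' (word cs) b'))

-- Every 231-avoiding permutation word is the word of a forest.  After its
-- first entry v, such a word consists of a permutation word of [v] followed
-- by the shift by v + 1 of a permutation word, since an entry above v can
-- never be followed by one below v.

length-⊆ : (xs ys : List A) → Unique xs → (∀ x → x ∈ xs → x ∈ ys) → length xs ≤ length ys
length-⊆ []       ys _            _   = z≤n
length-⊆ (x ∷ xs) ys (x∉xs ∷ uxs) sub with ∈-∃++ (sub x (here refl))
... | ys₁ , ys₂ , refl =
  subst (suc (length xs) ≤_) (sym (trans (length-++ ys₁) (trans (+-suc (length ys₁) (length ys₂)) (cong suc (sym (length-++ ys₁))))))
    (s≤s (length-⊆ xs (ys₁ ++ ys₂) uxs (λ z z∈ → dropX ys₁ (sub z (there z∈)) (λ eq → All.lookup x∉xs z∈ (sym eq)))))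
  where
  dropX : ∀ ys₁ {ys₂ z} → z ∈ ys₁ ++ x ∷ ys₂ → z ≢ x → z ∈ ys₁ ++ ys₂
  dropX []         (here eq) z≢x = ⊥-elim (z≢x eq)
  dropX []         (there p) _   = p
  dropX (y ∷ ys₁') (here eq) _   = here eq
  dropX (y ∷ ys₁') (there p) z≢x = there (dropX ys₁' p z≢x)

permWord-length : ∀ m l → IsPermWord m l → length l ≡ m
permWord-length m l (u , bound , covers) = ≤-antisym
  (subst (length l ≤_) (length-upTo m) (length-⊆ l (upTo m) u (λ x x∈ → ∈-upTo⁺ (All.lookup bound x∈))))
  (subst (_≤ length l) (length-upTo m) (length-⊆ (upTo m) l (Unique.upTo⁺ m) (λ x x∈ → covers x (∈-upTo⁻ x∈))))

Unique-++⁻ : (xs ys : List A) → Unique (xs ++ ys) → Unique xs × Unique ys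
Unique-++⁻ []       ys u            = [] , u
Unique-++⁻ (x ∷ xs) ys (x∉ ∷ u) with Unique-++⁻ xs ys u
... | uxs , uys = All.++⁻ˡ xs x∉ ∷ uxs , uys

permWord-low : ∀ n v low high → IsPermWord (suc n) (v ∷ low ++ high) → All (_< v) low → All (v <_) high → IsPermWord v low
permWord-low n v low high (_ ∷ u , v<1+n ∷ _ , covers) low<v v<high =
  proj₁ (Unique-++⁻ low high u) , low<v , coversLow
  where
  coversLow : Covers v low
  coversLow y y<v with covers y (<-trans y<v v<1+n)
  ... | here y≡v = ⊥-elim (<-irrefl y≡v y<v)
  ... | there y∈ with ∈-++⁻ low y∈
  ...   | inj₁ p = p
  ...   | inj₂ p = ⊥-elim (<-asym y<v (All.lookup v<high p))

permWord-high : ∀ n v low high → IsPermWord (suc n) (v ∷ low ++ high) → All (_< v) low → All (v <_) high →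
                IsPermWord (n ∸ v) (map (_∸ suc v) high)
permWord-high n v low high (_ ∷ u , v<1+n ∷ bound , covers) low<v v<high =
  Unique-map (_∸ suc v) high unshiftInjective (proj₂ (Unique-++⁻ low high u)) ,
  All.map⁺ (All.tabulate (λ y∈ → ∸-monoˡ-< (All.lookup (All.++⁻ʳ low bound) y∈) (All.lookup v<high y∈))) ,
  coversHigh
  where
  unshiftInjective : ∀ {x y} → x ∈ high → y ∈ high → x ∸ suc v ≡ y ∸ suc v → x ≡ y
  unshiftInjective x∈ y∈ eq =
    trans (sym (m+[n∸m]≡n (All.lookup v<high x∈))) (trans (cong (suc v +_) eq) (m+[n∸m]≡n (All.lookup v<high y∈)))
  coversHigh : Covers (n ∸ v) (map (_∸ suc v) high)
  coversHigh z z< with covers (suc v + z) (s≤s (subst (v + z <_) (m+[n∸m]≡n (≤-pred v<1+n)) (+-monoʳ-< v z<)))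
  ... | here eq = ⊥-elim (<-irrefl (sym eq) (s≤s (m≤m+n v z)))
  ... | there y∈ with ∈-++⁻ low y∈
  ...   | inj₁ p = ⊥-elim (<-asym (All.lookup low<v p) (s≤s (m≤m+n v z)))
  ...   | inj₂ p = subst (_∈ map (_∸ suc v) high) (m+n∸m≡n (suc v) z) (∈-map⁺ (_∸ suc v) p)

HeadAtLeast : ℕ → List ℕ → Set
HeadAtLeast v []      = ⊤
HeadAtLeast v (y ∷ _) = v ≤ y

splitBelow : ∀ v l → Σ (List ℕ) λ low → Σ (List ℕ) λ high → l ≡ low ++ high × All (_< v) low × HeadAtLeast v high
splitBelow v []      = [] , [] , refl , [] , tt
splitBelow v (x ∷ l) with x <? v
... | no  x≮v = [] , x ∷ l , refl , [] , ≮⇒≥ x≮v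
... | yes x<v with splitBelow v l
...   | low , high , eq , low<v , head = x ∷ low , high , cong (x ∷_) eq , x<v ∷ low<v , head

aboveAfterFirst : ∀ v high → HeadAtLeast v high → Avoids231From v high → All (v ≢_) high → All (v <_) high
aboveAfterFirst v []       _    _            _               = []
aboveAfterFirst v (y ∷ ys) v≤y (after , _) (v≢y ∷ v≢ys) =
  v<y ∷ All.zipWith (λ (v≤z , v≢z) → ≤∧≢⇒< v≤z v≢z) (after v<y , v≢ys)
  where
  v<y : v < y
  v<y = ≤∧≢⇒< v≤y v≢y

unshift : ∀ v high → All (v <_) high → shift (suc v) (map (_∸ suc v) high) ≡ high
unshift v []       _              = refl
unshift v (y ∷ ys) (v<y ∷ v<ys) = cong₂ _∷_ (m+[n∸m]≡n v<y) (unshift v ys v<ys)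

record RootSplit (v n : ℕ) (rest : List ℕ) : Set where
  field
    low high    : List ℕ
    rest≡       : rest ≡ low ++ shift (suc v) high
    lowPerm     : IsPermWord v low
    highPerm    : IsPermWord (n ∸ v) high
    lowAvoids   : Avoids231L low
    highAvoids  : Avoids231L high

rootSplit : ∀ v rest → IsPermWord (suc (length rest)) (v ∷ rest) → Avoids231L (v ∷ rest) → RootSplit v (length rest) rest
rootSplit v rest perm@(v∉rest ∷ _ , _) (from , avoids) with splitBelow v rest
... | low , high , refl , low<v , head = record
  { low        = low
  ; high       = map (_∸ suc v) high
  ; rest≡      = cong (low ++_) (sym (unshift v high v<high))
  ; lowPerm    = permWord-low n v low high perm low<v v<high
  ; highPerm   = permWord-high n v low high perm low<v v<high
  ; lowAvoids  = Avoids231L-prefix low high avoids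
  ; highAvoids = Avoids231L-unshift (suc v) _ (subst Avoids231L (sym (unshift v high v<high)) (Avoids231L-suffix low high avoids))
  }
  where
  n = length (low ++ high)
  v<high : All (v <_) high
  v<high = aboveAfterFirst v high head (Avoids231From-suffix v low high from) (All.++⁻ʳ low v∉rest)

-- recursion on an upper bound for the size
word-onto : ∀ fuel m l → m ≤ fuel → IsPermWord m l → Avoids231L l → ∃[ F ] word F ≡ l
word-onto fuel       m []         _      _    _      = [] , refl
word-onto zero       m (v ∷ rest) m≤0    perm _      with trans (permWord-length m _ perm) (n≤0⇒n≡0 m≤0)
... | ()
word-onto (suc fuel) m (v ∷ rest) m≤fuel perm avoids with permWord-length m (v ∷ rest) perm
... | refl = node lowF ∷ highF , cong₂ _∷_ sizeLow (trans (cong₂ _++_ wordLow (cong₂ shift (cong suc sizeLow) wordHigh)) (sym rest≡))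
  where
  open RootSplit (rootSplit v rest perm avoids)
  n = length rest
  v≤n : v ≤ n
  v≤n = ≤-pred (All.head (proj₁ (proj₂ perm)))
  lowRec = word-onto fuel v low (≤-trans v≤n (≤-pred m≤fuel)) lowPerm lowAvoids
  highRec = word-onto fuel (n ∸ v) high (≤-trans (m∸n≤m n v) (≤-pred m≤fuel)) highPerm highAvoids
  lowF = proj₁ lowRec
  highF = proj₁ highRec
  wordLow : word lowF ≡ low
  wordLow = proj₂ lowRec
  wordHigh : word highF ≡ high
  wordHigh = proj₂ highRec
  sizeLow : edgesL lowF ≡ v
  sizeLow = trans (sym (length-word lowF)) (trans (cong length wordLow) (permWord-length v low lowPerm))

values : ∀ {m len} → Vec (Fin m) len → List ℕ
values σ = map toℕ (toList σ)

length-values : ∀ {m len} (σ : Vec (Fin m) len) → length (values σ) ≡ len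
length-values []      = refl
length-values (x ∷ σ) = cong suc (length-values σ)

values-bound : ∀ {m len} (σ : Vec (Fin m) len) → All (_< m) (values σ)
values-bound []      = []
values-bound (x ∷ σ) = toℕ<n x ∷ values-bound σ

lookup∈values : ∀ {m len} (σ : Vec (Fin m) len) i → toℕ (lookup σ i) ∈ values σ
lookup∈values (x ∷ σ) Fin.zero    = here refl
lookup∈values (x ∷ σ) (Fin.suc i) = there (lookup∈values σ i)

∈values⇒lookup : ∀ {m len} (σ : Vec (Fin m) len) y → y ∈ values σ → ∃[ i ] toℕ (lookup σ i) ≡ y
∈values⇒lookup (x ∷ σ) y (here eq) = Fin.zero , sym eq
∈values⇒lookup (x ∷ σ) y (there p) with ∈values⇒lookup σ y p
... | i , eq = Fin.suc i , eq

values-injective : ∀ {m len} (σ τ : Vec (Fin m) len) → values σ ≡ values τ → σ ≡ τ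
values-injective []      []      eq = refl
values-injective (x ∷ σ) (y ∷ τ) eq with ∷-injective eq
... | head , tail = cong₂ _∷_ (toℕ-injective head) (values-injective σ τ tail)

Injective : ∀ {m len} → Vec (Fin m) len → Set
Injective σ = ∀ i j → lookup σ i ≡ lookup σ j → i ≡ j

injective⇒unique : ∀ {m len} (σ : Vec (Fin m) len) → Injective σ → Unique (values σ)
injective⇒unique []      _   = []
injective⇒unique (x ∷ σ) inj =
  All.tabulate fresh ∷ injective⇒unique σ (λ i j eq → Data.Fin.Properties.suc-injective (inj (Fin.suc i) (Fin.suc j) eq))
  where
  fresh : ∀ {z} → z ∈ values σ → toℕ x ≢ z
  fresh {z} z∈ eq with ∈values⇒lookup σ z z∈
  ... | i , eq' with inj Fin.zero (Fin.suc i) (toℕ-injective (trans eq (sym eq')))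
  ...   | ()

unique⇒injective : ∀ {m len} (σ : Vec (Fin m) len) → Unique (values σ) → Injective σ
unique⇒injective (x ∷ σ) _          Fin.zero    Fin.zero    _  = refl
unique⇒injective (x ∷ σ) (x∉ ∷ _)  Fin.zero    (Fin.suc j) eq =
  ⊥-elim (All.lookup x∉ (subst (_∈ values σ) (cong toℕ (sym eq)) (lookup∈values σ j)) refl)
unique⇒injective (x ∷ σ) (x∉ ∷ _)  (Fin.suc i) Fin.zero    eq =
  ⊥-elim (All.lookup x∉ (subst (_∈ values σ) (cong toℕ eq) (lookup∈values σ i)) refl)
unique⇒injective (x ∷ σ) (_ ∷ u)   (Fin.suc i) (Fin.suc j) eq = cong Fin.suc (unique⇒injective σ u i j eq)

surjective⇒covers : ∀ {n} (σ : Vec (Fin n) n) → (∀ y → ∃[ i ] lookup σ i ≡ y) → Covers n (values σ)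
surjective⇒covers σ surj y y<n with surj (fromℕ< y<n)
... | i , eq = subst (_∈ values σ) (trans (cong toℕ eq) (toℕ-fromℕ< y<n)) (lookup∈values σ i)

covers⇒surjective : ∀ {n} (σ : Vec (Fin n) n) → Covers n (values σ) → (∀ y → ∃[ i ] lookup σ i ≡ y)
covers⇒surjective σ covers y with ∈values⇒lookup σ (toℕ y) (covers (toℕ y) (toℕ<n y))
... | i , eq = i , toℕ-injective eq

isPerm⇔isPermWord : ∀ {n} (σ : Vec (Fin n) n) → IsPerm σ ⇔ IsPermWord n (values σ)
isPerm⇔isPermWord σ = mk⇔
  (λ (inj , surj) → injective⇒unique σ inj , values-bound σ , surjective⇒covers σ surj)
  (λ (u , _ , covers) → unique⇒injective σ u , covers⇒surjective σ covers)

Avoids231V : ∀ {m len} → Vec (Fin m) len → Set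
Avoids231V {m} {len} σ = ¬ (Σ (Fin len) λ a → Σ (Fin len) λ b → Σ (Fin len) λ c →
   a Fin.< b × b Fin.< c × lookup σ c Fin.< lookup σ a × lookup σ a Fin.< lookup σ b)

Avoids231FromV : ∀ {m len} → Fin m → Vec (Fin m) len → Set
Avoids231FromV {m} {len} x σ = ¬ (Σ (Fin len) λ b → Σ (Fin len) λ c →
   b Fin.< c × lookup σ c Fin.< x × x Fin.< lookup σ b)

avoids231From⇒ : ∀ {m len} (x : Fin m) (σ : Vec (Fin m) len) → Avoids231FromV x σ → Avoids231From (toℕ x) (values σ)
avoids231From⇒ x []      _       = tt
avoids231From⇒ x (y ∷ σ) avoids =
  (λ x<y → All.tabulate (λ {z} z∈ → ≮⇒≥ (λ z<x → pattern231 z z∈ z<x x<y))) ,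
  avoids231From⇒ x σ (λ (b , c , b<c , cx , xb) → avoids (Fin.suc b , Fin.suc c , s≤s b<c , cx , xb))
  where
  pattern231 : ∀ z → z ∈ values σ → z < toℕ x → toℕ x < toℕ y → ⊥
  pattern231 z z∈ z<x x<y with ∈values⇒lookup σ z z∈
  ... | c , refl = avoids (Fin.zero , Fin.suc c , s≤s z≤n , z<x , x<y)

avoids231From⇐ : ∀ {m len} (x : Fin m) (σ : Vec (Fin m) len) → Avoids231From (toℕ x) (values σ) → Avoids231FromV x σ
avoids231From⇐ x (y ∷ σ) (after , _)    (Fin.zero  , Fin.suc c , _   , cx , xb) = <⇒≱ cx (All.lookup (after xb) (lookup∈values σ c))
avoids231From⇐ x (y ∷ σ) (_ , avoids)  (Fin.suc b , Fin.suc c , b<c , cx , xb) = avoids231From⇐ x σ avoids (b , c , ≤-pred b<c , cx , xb)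

avoids231⇒ : ∀ {m len} (σ : Vec (Fin m) len) → Avoids231V σ → Avoids231L (values σ)
avoids231⇒ []      _      = tt
avoids231⇒ (x ∷ σ) avoids =
  avoids231From⇒ x σ (λ (b , c , b<c , cx , xb) → avoids (Fin.zero , Fin.suc b , Fin.suc c , s≤s z≤n , s≤s b<c , cx , xb)) ,
  avoids231⇒ σ (λ (a , b , c , a<b , b<c , ca , ab) → avoids (Fin.suc a , Fin.suc b , Fin.suc c , s≤s a<b , s≤s b<c , ca , ab))

avoids231⇐ : ∀ {m len} (σ : Vec (Fin m) len) → Avoids231L (values σ) → Avoids231V σ
avoids231⇐ (x ∷ σ) (from , _)  (Fin.zero  , Fin.suc b , Fin.suc c , _   , b<c , ca , ab) = avoids231From⇐ x σ from (b , c , ≤-pred b<c , ca , ab)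
avoids231⇐ (x ∷ σ) (_ , avoids) (Fin.suc a , Fin.suc b , Fin.suc c , a<b , b<c , ca , ab) =
  avoids231⇐ σ avoids (a , b , c , ≤-pred a<b , ≤-pred b<c , ca , ab)
avoids231⇐ (x ∷ σ) _ (Fin.zero  , Fin.zero  , _         , () , _)
avoids231⇐ (x ∷ σ) _ (_         , Fin.suc b , Fin.zero  , _  , () , _)
avoids231⇐ (x ∷ σ) _ (Fin.suc a , Fin.zero  , _         , () , _)

DropBoundV : ∀ {m len} → ℕ → ℕ → Vec (Fin m) len → Set
DropBoundV o h σ = ∀ i → o + toℕ i < toℕ (lookup σ i) + h

dropBound⇒ : ∀ {m len} o h (σ : Vec (Fin m) len) → DropBoundV o h σ → DropBound o h (values σ)
dropBound⇒ o h []      _     = tt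
dropBound⇒ o h (x ∷ σ) bound =
  subst (_< toℕ x + h) (+-identityʳ o) (bound Fin.zero) ,
  dropBound⇒ (suc o) h σ (λ i → subst (_< toℕ (lookup σ i) + h) (+-suc o (toℕ i)) (bound (Fin.suc i)))

dropBound⇐ : ∀ {m len} o h (σ : Vec (Fin m) len) → DropBound o h (values σ) → DropBoundV o h σ
dropBound⇐ o h (x ∷ σ) (bx , _)  Fin.zero    = subst (_< toℕ x + h) (sym (+-identityʳ o)) bx
dropBound⇐ o h (x ∷ σ) (_ , bσ)  (Fin.suc i) = subst (_< toℕ (lookup σ i) + h) (sym (+-suc o (toℕ i))) (dropBound⇐ (suc o) h σ bσ i)

maxDrop⇔dropBound : ∀ {n} (σ : Vec (Fin n) n) k → MaxDropLe σ k ⇔ DropBound 0 (suc k) (values σ)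
maxDrop⇔dropBound σ k = mk⇔
  (λ le → dropBound⇒ 0 (suc k) σ (λ i → subst (toℕ i <_) (sym (+-suc (toℕ (lookup σ i)) k)) (s≤s (le i))))
  (λ b i → ≤-pred (subst (toℕ i <_) (+-suc (toℕ (lookup σ i)) k) (dropBound⇐ 0 (suc k) σ b i)))

WordP : ℕ → ℕ → ℕ → List ℕ → Set
WordP n d k l = IsPermWord n l × Avoids231L l × desL l ≡ d × DropBound 0 (suc k) l

permP⇔wordP : ∀ n d k (σ : Vec (Fin n) n) → PermP n d k σ ⇔ WordP n d k (values σ)
permP⇔wordP n d k σ = mk⇔
  (λ (perm , avoids , des , drop) →
     Equivalence.to (isPerm⇔isPermWord σ) perm , avoids231⇒ σ avoids , des , Equivalence.to (maxDrop⇔dropBound σ k) drop)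
  (λ (perm , avoids , des , drop) →
     Equivalence.from (isPerm⇔isPermWord σ) perm , avoids231⇐ σ avoids , des , Equivalence.from (maxDrop⇔dropBound σ k) drop)

finOr : ∀ {m} → Fin m → ℕ → Fin m
finOr {m} default x with x <? m
... | yes x<m = fromℕ< x<m
... | no  _   = default

toℕ-finOr : ∀ {m} (default : Fin m) x → x < m → toℕ (finOr default x) ≡ x
toℕ-finOr {m} default x x<m with x <? m
... | yes x<m' = toℕ-fromℕ< x<m'
... | no  x≮m  = ⊥-elim (x≮m x<m)

padded : ∀ {m} → Fin m → (len : ℕ) → List ℕ → Vec (Fin m) len
padded default zero      _       = []
padded default (suc len) []      = default ∷ padded default len []
padded default (suc len) (x ∷ l) = finOr default x ∷ padded default len l

values-padded : ∀ {m} (default : Fin m) len l → All (_< m) l → length l ≡ len → values (padded default len l) ≡ l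
values-padded default zero      []      _           _   = refl
values-padded default (suc len) (x ∷ l) (x<m ∷ l<m) len≡ =
  cong₂ _∷_ (toℕ-finOr default x x<m) (values-padded default len l l<m (suc-injective len≡))

fromWord : (n : ℕ) → List ℕ → Vec (Fin n) n
fromWord zero    _ = []
fromWord (suc n) l = padded Fin.zero (suc n) l

values-fromWord : ∀ n l → All (_< n) l → length l ≡ n → values (fromWord n l) ≡ l
values-fromWord zero    []  _     _   = refl
values-fromWord (suc n) l   bound len = values-padded Fin.zero (suc n) l bound len

forest-size : ∀ n j h F → j ≤ n → ForestP h j (n ∸ j) F → edgesL F ≡ n
forest-size n j h F j≤n (_ , leavesF , innerF) =
  trans (edges≡leaves+inner F) (trans (cong₂ _+_ leavesF innerF) (m+[n∸m]≡n j≤n))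

forestP⇒wordP : ∀ n j k F → j ≤ n → ForestP (suc k) j (n ∸ j) F → WordP n (n ∸ j) k (word F)
forestP⇒wordP n j k F j≤n forestP@(heightF , _ , innerF) =
  subst (λ m → IsPermWord m (word F)) (forest-size n j (suc k) F j≤n forestP) (word-isPermWord F) ,
  word-avoids231 F ,
  trans (word-descents F) innerF ,
  word-dropBound F (suc k) heightF

wordP⇒forestP : ∀ n j k F → j ≤ n → edgesL F ≡ n → WordP n (n ∸ j) k (word F) → ForestP (suc k) j (n ∸ j) F
wordP⇒forestP n j k F j≤n size (_ , _ , des , drop) = dropBound-height F (suc k) drop , leavesF , innerF
  where
  innerF : inner F ≡ n ∸ j
  innerF = trans (sym (word-descents F)) des
  leavesF : leavesL F ≡ j
  leavesF = begin
    leavesL F                       ≡⟨ sym (m+n∸n≡m (leavesL F) (inner F)) ⟩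
    leavesL F + inner F ∸ inner F   ≡⟨ cong₂ _∸_ (trans (sym (edges≡leaves+inner F)) size) innerF ⟩
    n ∸ (n ∸ j)                     ≡⟨ m∸[m∸n]≡n j≤n ⟩
    j                               ∎
    where open ≡-Reasoning

perms-HasCard : ∀ n j k → j ≤ n → HasCard (Vec (Fin n) n) (PermP n (n ∸ j) k) (length (forests (suc k) j (n ∸ j)))
perms-HasCard n j k j≤n =
  HasCard-bij toPerm toPerm-injective into onto (forests-HasCard (suc k) j (n ∸ j))
  where
  toPerm : List Tree → Vec (Fin n) n
  toPerm F = fromWord n (word F)
  values-toPerm : ∀ F → ForestP (suc k) j (n ∸ j) F → values (toPerm F) ≡ word F
  values-toPerm F forestP = values-fromWord n (word F)
    (subst (λ m → All (_< m) (word F)) size (word-bound F)) (trans (length-word F) size)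
    where size = forest-size n j (suc k) F j≤n forestP
  toPerm-injective : ∀ {F F'} → ForestP (suc k) j (n ∸ j) F → ForestP (suc k) j (n ∸ j) F' → toPerm F ≡ toPerm F' → F ≡ F'
  toPerm-injective {F} {F'} p p' eq = word-injective F F' (trans (sym (values-toPerm F p)) (trans (cong values eq) (values-toPerm F' p')))
  into : ∀ F → ForestP (suc k) j (n ∸ j) F → PermP n (n ∸ j) k (toPerm F)
  into F forestP = Equivalence.from (permP⇔wordP n (n ∸ j) k (toPerm F))
    (subst (WordP n (n ∸ j) k) (sym (values-toPerm F forestP)) (forestP⇒wordP n j k F j≤n forestP))
  onto : ∀ σ → PermP n (n ∸ j) k σ → ∃[ F ] (ForestP (suc k) j (n ∸ j) F × toPerm F ≡ σ)
  onto σ permP with Equivalence.to (permP⇔wordP n (n ∸ j) k σ) permP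
  ... | wordP@(perm , avoids , _) with word-onto n n (values σ) ≤-refl perm avoids
  ...   | F , wordF = F , forestP , values-injective (toPerm F) σ (trans (values-toPerm F forestP) wordF)
    where
    size : edgesL F ≡ n
    size = trans (sym (length-word F)) (trans (cong length wordF) (length-values σ))
    forestP : ForestP (suc k) j (n ∸ j) F
    forestP = wordP⇒forestP n j k F j≤n size (subst (WordP n (n ∸ j) k) (sym wordF) wordP)

corollary21 : (n j k : ℕ) → j ≤ n → 3 ≤ k →
    HasCard Tree (TreeP n j k) (binomSum n j k)
    × HasCard (Vec (Fin n) n) (PermP n (n ∸ j) (k ∸ 1)) (binomSum n j k)
corollary21 n j (suc k) j≤n 3≤k =
  subst (HasCard Tree (TreeP n j (suc k))) count (trees-HasCard n j (suc k) j≤n) ,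
  subst (HasCard (Vec (Fin n) n) (PermP n (n ∸ j) k)) count (perms-HasCard n j k j≤n)
  where
  count : length (forests (suc k) j (n ∸ j)) ≡ binomSum n j (suc k)
  count = length-forests≡binomSum n j (suc k) j≤n (≤-trans (n≤1+n 2) 3≤k)
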